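{- Let $p$ be a prime, $R$ an $\mathbb{F}_p$-algebra and $\lambda\in R$. Then the unit group scheme of the group algebra of $G^{(\lambda)}_R$ is $$U(G^{(\lambda)}_R)=\mathrm{Spec}\,R\Big[T_{X^{r_1}Y^{r_2}},\frac1D\Big]_{0\le r_1,r_2\le p-1},\qquad D=\prod_{r=0}^{p-1}\Big(\sum_{k=0}^{r}\binom{r}{k}\lambda^kT_{X^k}\Big)^p.$$
   Context: Throughout, $p$ is a prime, $R$ is a commutative $\mathbb{F}_p$-algebra and $\lambda\in R$. $\mathcal H^{(\lambda)}_R=\mathrm{Spec}\,R[X,Y,\frac1{1+\lambda X}]$ is the group scheme with: - comultiplication $X\mapsto X\otimes1+(1+\lambda X)\otimes X$ and $Y\mapsto Y\otimes1+(1+\lambda X)\otimes Y$; - counit $X,Y\mapsto0$; - antipode $X\mapsto-X/(1+\lambda X)$ and $Y\mapsto-Y/(1+\lambda X)$. The Frobenius $F:\mathcal H^{(\lambda)}_R\to\mathcal H^{(\lambda^p)}_R$ is $X\mapsto X^p$, $Y\mapsto Y^p$. Its kernel is $G^{(\lambda)}_R=\mathrm{Spec}\,A^{(\lambda)}_R$ with $A^{(\lambda)}_R=R[X,Y]/(X^p,Y^p)$ and the same structure formulas. Its $R$-basis is $X^{r_1}Y^{r_2}$, $0\le r_1,r_2\le p-1$. For an $R$-Hopf algebra $H$ that is free with basis $e_1,\dots,e_n$ and $\Gamma=\mathrm{Spec}\,H$: - The group algebra scheme is $A(\Gamma)(B)=\mathrm{Hom}_R(H,B)$ with the convolution product. It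 is represented by $\mathrm{Spec}\,R[T_{e_1},\dots,T_{e_n}]$, a point $f$ corresponding to $T_{e_i}\mapsto f(e_i)$. - Write $\Delta_H(e_j)=\sum_ie_i\otimes R_{ij}(e_1,\dots,e_n)$ with $R_{ij}$ linear forms. - The unit group scheme $U(\Gamma)$, $B\mapsto A(\Gamma)(B)^\times$, is represented by $R[T_{e_1},\dots,T_{e_n},1/\det(R_{ij}(T_{e_1},\dots,T_{e_n}))]$. For $G^{(\lambda)}_R$, the variable attached to $X^{r_1}Y^{r_2}$ is $T_{X^{r_1}Y^{r_2}}$, and $T_{X^k}:=T_{X^kY^0}$ (so $T_{X^0}=T_1$). -}

module Defs where

open import Level using (Level; _⊔_)
open import Data.Nat using (ℕ; zero; suc)
import Data.Nat as ℕ
open import Data.Nat.Combinatorics using (_C_)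
open import Data.Fin using (Fin; toℕ)
import Data.Fin as Fin
open import Data.Product using (_×_; _,_; proj₁; proj₂; Σ; ∃)
open import Data.Bool using (if_then_else_)
open import Relation.Nullary using (does)
open import Algebra.Bundles using (CommutativeRing)
open import Algebra.Morphism.Structures using (module RingMorphisms)

module RingOps {c ℓ : Level} (B : CommutativeRing c ℓ) where
  open CommutativeRing B

  fromℕ : ℕ → Carrier
  fromℕ zero    = 0#
  fromℕ (suc n) = 1# + fromℕ n

  pow : Carrier → ℕ → Carrier
  pow x zero    = 1#
  pow x (suc n) = x * pow x n

  sumℕ : ℕ → (ℕ → Carrier) → Carrier
  sumℕ zero    g = 0#
  sumℕ (suc n) g = sumℕ n g + g n

  prodℕ : ℕ → (ℕ → Carrier) → Carrier
  prodℕ zero    g = 1#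
  prodℕ (suc n) g = prodℕ n g * g n

  sumFin : (n : ℕ) → (Fin n → Carrier) → Carrier
  sumFin zero    g = 0#
  sumFin (suc n) g = g Fin.zero + sumFin n (λ i → g (Fin.suc i))

  δ : ℕ → ℕ → Carrier
  δ m n = if does (m ℕ.≟ n) then 1# else 0#

  IsUnit : Carrier → Set (c ⊔ ℓ)
  IsUnit x = ∃ λ y → x * y ≈ 1#

-- The Hopf algebra A^(λ) = R[X,Y]/(X^p,Y^p), base-changed to B, and the
-- group algebra scheme A(G^(λ))(B) = Hom_R(A^(λ), B) with convolution.
-- A monomial X^{r1} Y^{r2} (0 ≤ r1,r2 ≤ p-1) is indexed by (r1 , r2).
-- An element f of Hom_R(A,B) is given by its values on the basis,
-- i.e. by the point (T_{X^{r1}Y^{r2}} ↦ f(X^{r1}Y^{r2})).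

module GroupAlgebra {c ℓ : Level} (B : CommutativeRing c ℓ) (p : ℕ) (lam : CommutativeRing.Carrier B) where
  open CommutativeRing B
  open RingOps B

  Mono : Set
  Mono = Fin p × Fin p

  sumMono : (Mono → Carrier) → Carrier
  sumMono g = sumFin p (λ i → sumFin p (λ j → g (i , j)))

  e₁ e₂ : Mono → ℕ
  e₁ m = toℕ (proj₁ m)
  e₂ m = toℕ (proj₂ m)

  -- A_B ⊗_B A_B = B[X₁,Y₁,X₂,Y₂]/(X₁^p,Y₁^p,X₂^p,Y₂^p), an element being
  -- its coefficient function on basis elements (X^aY^b ⊗ X^cY^d).
  Tensor : Set c
  Tensor = Mono → Mono → Carrier

  _⊕_ : Tensor → Tensor → Tensor
  (u ⊕ v) m n = u m n + v m n

  scale : Carrier → Tensor → Tensor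
  scale a u m n = a * u m n

  -- the basis element X^a Y^b ⊗ X^c Y^d (zero if some exponent ≥ p)
  basis : ℕ → ℕ → ℕ → ℕ → Tensor
  basis a b c' d m n = δ (e₁ m) a * δ (e₂ m) b * (δ (e₁ n) c' * δ (e₂ n) d)

  _⊗·_ : Tensor → Tensor → Tensor
  (u ⊗· v) m n =
    sumMono λ m₁ → sumMono λ m₂ → sumMono λ n₁ → sumMono λ n₂ →
      (δ (e₁ m₁ ℕ.+ e₁ m₂) (e₁ m) * δ (e₂ m₁ ℕ.+ e₂ m₂) (e₂ m)
        * (δ (e₁ n₁ ℕ.+ e₁ n₂) (e₁ n) * δ (e₂ n₁ ℕ.+ e₂ n₂) (e₂ n)))
      * (u m₁ n₁ * v m₂ n₂)

  oneT : Tensor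
  oneT = basis 0 0 0 0

  powT : Tensor → ℕ → Tensor
  powT u zero    = oneT
  powT u (suc k) = u ⊗· powT u k

  -- Δ(X) = X ⊗ 1 + (1 + λX) ⊗ X,   Δ(Y) = Y ⊗ 1 + (1 + λX) ⊗ Y
  ΔX ΔY : Tensor
  ΔX = (basis 1 0 0 0 ⊕ basis 0 0 1 0) ⊕ scale lam (basis 1 0 1 0)
  ΔY = (basis 0 1 0 0 ⊕ basis 0 0 0 1) ⊕ scale lam (basis 1 0 0 1)

  Δ : Mono → Tensor
  Δ m = powT ΔX (e₁ m) ⊗· powT ΔY (e₂ m)

  ε : Mono → Carrier
  ε m = δ (e₁ m) 0 * δ (e₂ m) 0

  Point : Set c
  Point = Mono → Carrier

  conv : Point → Point → Point
  conv f g m = sumMono λ n₁ → sumMono λ n₂ → Δ m n₁ n₂ * (f n₁ * g n₂)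

  -- f ∈ A(G)(B)^×  i.e.  f is a B-point of the unit group scheme U(G)
  IsConvUnit : Point → Set (c ⊔ ℓ)
  IsConvUnit f = ∃ λ g → ((m : Mono) → conv f g m ≈ ε m)
                       × ((m : Mono) → conv g f m ≈ ε m)

  -- the coordinate T_{X^a Y^b} evaluated at f (0 if a or b ≥ p)
  T : Point → ℕ → ℕ → Carrier
  T f a b = sumMono λ m → δ (e₁ m) a * δ (e₂ m) b * f m

  D : Point → Carrier
  D f = prodℕ p λ r →
          pow (sumℕ (suc r) λ k → fromℕ (r C k) * pow lam k * T f k 0) p

-- ring homomorphisms R → B (making B an R-algebra)
IsRingHom : {a ℓa b ℓb : Level} (R : CommutativeRing a ℓa) (B : CommutativeRing b ℓb)
          → (CommutativeRing.Carrier R → CommutativeRing.Carrier B) → Set (a ⊔ ℓa ⊔ ℓb)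
IsRingHom R B φ =
  RingMorphisms.IsRingHomomorphism (CommutativeRing.rawRing R) (CommutativeRing.rawRing B) φ

-- In the basis X^a Y^b, left convolution g ↦ f ⋆ g by a point f of A(G)(B) is
-- triangular for the total degree: Δ(X^a Y^b) = (1 + λX)^(a+b) ⊗ X^a Y^b plus
-- terms whose right factor has smaller exponents, because X and Y are
-- (1, 1 + λX)-skew-primitive.  The diagonal entries are χ_r(f) = f((1 + λX)^r).
-- Since 1 + λX is grouplike, χ_r(f ⋆ g) = χ_r(f) χ_r(g) and χ_r(ε) = 1, so the
-- χ_r(f) of a unit f are units.  Conversely, invertible diagonal entries give a
-- right inverse g by back substitution; g has invertible χ_r as well, hence a
-- right inverse h, and associativity of ⋆ forces f = h.  In characteristic p,
-- (1 + λX)^p = 1, so χ_r depends only on r mod p, and by the binomial theorem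
-- χ_r(f) = Σ_k C(r,k) λ^k f(X^k) is the r-th factor of D(f).

module Submission where

open import Defs
open import Level using (Level; _⊔_)
open import Data.Nat using (ℕ)
open import Data.Nat.Primality using (Prime)
open import Algebra.Bundles using (CommutativeRing; CommutativeSemiring)
open import Function.Bundles using (_⇔_; mk⇔)
open import Function.Construct.Composition using (_⇔-∘_)

open import Data.Nat as ℕ using (zero; suc; _≤_; _<_; z≤n; s≤s; NonZero; NonTrivial)
import Data.Nat.Properties as ℕ
open import Data.Nat.Divisibility using (_∣_; divides; ∣1⇒≡1; ∣⇒≤; m∣m*n)
open import Data.Nat.Combinatorics using (_C_; nCn≡1; nCk≡n!/k![n-k]!; k![n∸k]!∣n!)
open import Data.Nat.DivMod using (m/n*n≡m)
open import Data.Nat.Primality using (euclidsLemma; prime⇒nonTrivial)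
open import Data.Fin as Fin using (Fin; toℕ; fromℕ<)
import Data.Fin.Properties as Fin
open import Data.Product using (_×_; _,_; proj₁; proj₂; ∃)
open import Data.Product.Properties using (≡-dec)
open import Data.Sum using (_⊎_; inj₁; inj₂; [_,_]; map)
open import Data.Empty using (⊥-elim)
open import Relation.Binary.PropositionalEquality as ≡ using (_≡_; _≢_)
open import Relation.Binary.Definitions using (DecidableEquality; tri<; tri≈; tri>)
open import Relation.Nullary using (yes; no; ¬_)
open import Algebra.Structures using (IsCommutativeMonoid)
open import Algebra.Structures.Biased using (IsCommutativeSemiringˡ)
open import Algebra.Morphism.Structures using (module RingMorphisms; module MonoidMorphisms)
open import Algebra.Morphism.Construct.Composition using (isMonoidHomomorphism)
import Algebra.Construct.Pointwise
import Algebra.Properties.CommutativeSemigroup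
import Algebra.Properties.CommutativeSemiring.Binomial
import Algebra.Properties.Semiring.Exp
import Algebra.Properties.Semiring.Mult
import Algebra.Properties.Semiring.Sum

prime∤factorial : ∀ {p} → Prime p → ∀ m → m < p → ¬ (p ∣ m ℕ.!)
prime∤factorial {p} pp zero _ p∣1 = ℕ.<-irrefl (≡.sym (∣1⇒≡1 p∣1)) (ℕ.nonTrivial⇒n>1 p {{prime⇒nonTrivial pp}})
prime∤factorial pp (suc m) m<p p∣m! with euclidsLemma (suc m) (m ℕ.!) pp p∣m!
... | inj₁ p∣1+m = ℕ.<⇒≱ m<p (∣⇒≤ p∣1+m)
... | inj₂ p∣m!  = prime∤factorial pp m (ℕ.<-trans (ℕ.n<1+n m) m<p) p∣m!

prime∣binomial : ∀ {p k} → Prime p → 0 < k → k < p → p ∣ p C k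
prime∣binomial {p} {k} pp 0<k k<p
  with euclidsLemma (p C k) (k ℕ.! ℕ.* (p ℕ.∸ k) ℕ.!) pp p∣C*k!*[p-k]!
  where
  instance _ = k ℕ.!* (p ℕ.∸ k) !≢0
  p∣C*k!*[p-k]! : p ∣ (p C k) ℕ.* (k ℕ.! ℕ.* (p ℕ.∸ k) ℕ.!)
  p∣C*k!*[p-k]! = ≡.subst (p ∣_)
    (≡.sym (≡.trans (≡.cong (ℕ._* (k ℕ.! ℕ.* (p ℕ.∸ k) ℕ.!)) (nCk≡n!/k![n-k]! (ℕ.<⇒≤ k<p)))
                    (m/n*n≡m (k![n∸k]!∣n! (ℕ.<⇒≤ k<p)))))
    (p∣p! p (ℕ.<-trans 0<k k<p))
    where
    p∣p! : ∀ n → 0 < n → n ∣ n ℕ.!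
    p∣p! (suc n) _ = m∣m*n (n ℕ.!)
... | inj₁ p∣C = p∣C
... | inj₂ p∣k!*[p-k]! with euclidsLemma (k ℕ.!) ((p ℕ.∸ k) ℕ.!) pp p∣k!*[p-k]!
...   | inj₁ p∣k! = ⊥-elim (prime∤factorial pp k k<p p∣k!)
...   | inj₂ p∣[p-k]! = ⊥-elim (prime∤factorial pp (p ℕ.∸ k) (ℕ.∸-monoʳ-< 0<k (ℕ.<⇒≤ k<p)) p∣[p-k]!)

+-≡-split : ∀ {u v a c} → u ℕ.+ v ≡ a ℕ.+ c → (u ≡ a × v ≡ c) ⊎ (a < u ⊎ c < v)
+-≡-split {u} {v} {a} {c} sum≡ with ℕ.<-cmp u a
... | tri> _ _ a<u     = inj₂ (inj₁ a<u)
... | tri≈ _ ≡.refl _  = inj₁ (≡.refl , ℕ.+-cancelˡ-≡ u v c sum≡)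
... | tri< u<a _ _ with c ℕ.<? v
...   | yes c<v = inj₂ (inj₂ c<v)
...   | no  c≮v = ⊥-elim (ℕ.<-irrefl sum≡ (ℕ.+-mono-<-≤ u<a (ℕ.≮⇒≥ c≮v)))

+-<-split : ∀ {u v a c} → a ℕ.+ c < u ℕ.+ v → a < u ⊎ c < v
+-<-split {u} {v} {a} {c} sum< with a ℕ.<? u | c ℕ.<? v
... | yes a<u | _       = inj₁ a<u
... | no  _   | yes c<v = inj₂ c<v
... | no  a≮u | no  c≮v = ⊥-elim (ℕ.<⇒≱ sum< (ℕ.+-mono-≤ (ℕ.≮⇒≥ a≮u) (ℕ.≮⇒≥ c≮v)))

module Characteristic {c ℓ} (B : CommutativeRing c ℓ) where
  open CommutativeRing B hiding (zero)
  open RingOps B using (fromℕ)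
  open import Relation.Binary.Reasoning.Setoid setoid

  fromℕ-+ : ∀ m n → fromℕ (m ℕ.+ n) ≈ fromℕ m + fromℕ n
  fromℕ-+ zero    n = sym (+-identityˡ _)
  fromℕ-+ (suc m) n = trans (+-congˡ (fromℕ-+ m n)) (sym (+-assoc _ _ _))

  fromℕ-* : ∀ m n → fromℕ (m ℕ.* n) ≈ fromℕ m * fromℕ n
  fromℕ-* zero    n = sym (zeroˡ _)
  fromℕ-* (suc m) n = begin
    fromℕ (n ℕ.+ m ℕ.* n)             ≈⟨ fromℕ-+ n (m ℕ.* n) ⟩
    fromℕ n + fromℕ (m ℕ.* n)         ≈⟨ +-cong (sym (*-identityˡ _)) (fromℕ-* m n) ⟩
    1# * fromℕ n + fromℕ m * fromℕ n  ≈⟨ sym (distribʳ _ _ _) ⟩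
    (1# + fromℕ m) * fromℕ n          ∎

  fromℕ-binomial≈0 : ∀ {p} → Prime p → fromℕ p ≈ 0# → ∀ k → 0 < k → k < p → fromℕ (p C k) ≈ 0#
  fromℕ-binomial≈0 {p} pp p≈0 k 0<k k<p with prime∣binomial pp 0<k k<p
  ... | divides t C≡t*p = begin
    fromℕ (p C k)      ≡⟨ ≡.cong fromℕ C≡t*p ⟩
    fromℕ (t ℕ.* p)    ≈⟨ fromℕ-* t p ⟩
    fromℕ t * fromℕ p  ≈⟨ *-congˡ p≈0 ⟩
    fromℕ t * 0#       ≈⟨ zeroʳ _ ⟩
    0#                 ∎

module _ {a ℓa b ℓb : Level} (R : CommutativeRing a ℓa) (B : CommutativeRing b ℓb)
         {φ : CommutativeRing.Carrier R → CommutativeRing.Carrier B} (homo : IsRingHom R B φ) where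
  open CommutativeRing B
  open RingMorphisms (CommutativeRing.rawRing R) (CommutativeRing.rawRing B)
  open IsRingHomomorphism homo using (+-homo; 0#-homo; 1#-homo; ⟦⟧-cong)

  fromℕ-homo : ∀ n → φ (RingOps.fromℕ R n) ≈ RingOps.fromℕ B n
  fromℕ-homo zero    = 0#-homo
  fromℕ-homo (suc n) = trans (+-homo _ _) (+-cong 1#-homo (fromℕ-homo n))

  fromℕ≈0-homo : ∀ n → CommutativeRing._≈_ R (RingOps.fromℕ R n) (CommutativeRing.0# R) →
                 RingOps.fromℕ B n ≈ 0#
  fromℕ≈0-homo n n≈0 = trans (sym (fromℕ-homo n)) (trans (⟦⟧-cong n≈0) 0#-homo)

module FreshmansDream {c ℓ} (S : CommutativeSemiring c ℓ) where
  open CommutativeSemiring S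
  open import Algebra.Properties.Semiring.Exp semiring using (_^_)
  open import Algebra.Properties.Semiring.Mult semiring using () renaming (_×_ to _×ᴺ_)
  open import Algebra.Properties.Semiring.Sum semiring using (sum; sum-init-last; sum-cong-≋; sum-replicate-zero)
  open import Algebra.Properties.CommutativeSemiring.Binomial S using (theorem; binomialTerm)
  open import Relation.Binary.Reasoning.Setoid setoid

  ^-distrib-+ : ∀ n .{{_ : NonZero n}} → (∀ k → 0 < k → k < n → ∀ z → (n C k) ×ᴺ z ≈ 0#) →
                ∀ x y → (x + y) ^ n ≈ x ^ n + y ^ n
  ^-distrib-+ (suc m) C≈0 x y = begin
    (x + y) ^ suc m                                            ≈⟨ theorem (suc m) x y ⟩
    term Fin.zero + sum (λ k → term (Fin.suc k))               ≈⟨ +-congˡ (sum-init-last (λ k → term (Fin.suc k))) ⟩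
    term Fin.zero + (sum middle + term (Fin.fromℕ (suc m)))
      ≈⟨ +-congˡ (+-congʳ (trans (sum-cong-≋ middle≈0) (sum-replicate-zero m))) ⟩
    term Fin.zero + (0# + term (Fin.fromℕ (suc m)))            ≈⟨ +-cong (trans (+-identityʳ _) (*-identityˡ _)) (+-identityˡ _) ⟩
    y ^ suc m + term (Fin.fromℕ (suc m))                       ≈⟨ +-comm _ _ ⟩
    term (Fin.fromℕ (suc m)) + y ^ suc m                       ≈⟨ +-congʳ last≈x^n ⟩
    x ^ suc m + y ^ suc m                                      ∎
    where
    term = binomialTerm x y (suc m)
    middle : Fin m → Carrier
    middle k = term (Fin.suc (Fin.inject₁ k))
    middle≈0 : ∀ k → middle k ≈ 0#
    middle≈0 k = C≈0 (suc (toℕ (Fin.inject₁ k))) (s≤s z≤n)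
      (s≤s (≡.subst (_< m) (≡.sym (Fin.toℕ-inject₁ k)) (Fin.toℕ<n k))) _
    last≈x^n : term (Fin.fromℕ (suc m)) ≈ x ^ suc m
    last≈x^n = begin
      term (Fin.fromℕ (suc m))
        ≡⟨ ≡.cong (λ k → (suc m C k) ×ᴺ (x ^ k * y ^ (suc m ℕ.∸ k))) (Fin.toℕ-fromℕ (suc m)) ⟩
      (suc m C suc m) ×ᴺ (x ^ suc m * y ^ (m ℕ.∸ m))
        ≡⟨ ≡.cong₂ (λ i j → i ×ᴺ (x ^ suc m * y ^ j)) (nCn≡1 (suc m)) (ℕ.n∸n≡0 m) ⟩
      1 ×ᴺ (x ^ suc m * 1#)
        ≈⟨ trans (+-identityʳ _) (*-identityʳ _) ⟩
      x ^ suc m ∎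

module Units {c ℓ} (B : CommutativeRing c ℓ) where
  open CommutativeRing B
  open RingOps B

  IsUnit-resp-≈ : ∀ {x y} → x ≈ y → IsUnit x → IsUnit y
  IsUnit-resp-≈ x≈y (z , xz≈1) = z , trans (*-congʳ (sym x≈y)) xz≈1

  IsUnit-1# : IsUnit 1#
  IsUnit-1# = 1# , *-identityˡ 1#

  IsUnit-*⁻ˡ : ∀ {x y} → IsUnit (x * y) → IsUnit x
  IsUnit-*⁻ˡ {x} {y} (z , xyz≈1) = y * z , trans (sym (*-assoc _ _ _)) xyz≈1

  IsUnit-*⁻ʳ : ∀ {x y} → IsUnit (x * y) → IsUnit y
  IsUnit-*⁻ʳ {x} {y} u = IsUnit-*⁻ˡ (IsUnit-resp-≈ (*-comm x y) u)

  IsUnit-* : ∀ {x y} → IsUnit x → IsUnit y → IsUnit (x * y)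
  IsUnit-* (x′ , xx′≈1) (y′ , yy′≈1) =
    x′ * y′ , trans (interchange _ _ x′ y′) (trans (*-cong xx′≈1 yy′≈1) (*-identityˡ 1#))
    where open import Algebra.Properties.CommutativeSemigroup *-commutativeSemigroup using (interchange)

  IsUnit-pow : ∀ {x} n → IsUnit x → IsUnit (pow x n)
  IsUnit-pow zero    _ = IsUnit-1#
  IsUnit-pow (suc n) u = IsUnit-* u (IsUnit-pow n u)

  IsUnit-pow⁻ : ∀ {x} n .{{_ : NonZero n}} → IsUnit (pow x n) → IsUnit x
  IsUnit-pow⁻ (suc n) = IsUnit-*⁻ˡ

  IsUnit-prodℕ : ∀ n {g} → (∀ r → r < n → IsUnit (g r)) → IsUnit (prodℕ n g)
  IsUnit-prodℕ zero    _  = IsUnit-1#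
  IsUnit-prodℕ (suc n) us = IsUnit-* (IsUnit-prodℕ n (λ r r<n → us r (ℕ.m<n⇒m<1+n r<n))) (us n ℕ.≤-refl)

  IsUnit-prodℕ⁻ : ∀ n {g} → IsUnit (prodℕ n g) → ∀ r → r < n → IsUnit (g r)
  IsUnit-prodℕ⁻ (suc n) u r r<1+n with r ℕ.≟ n
  ... | yes ≡.refl = IsUnit-*⁻ʳ u
  ... | no r≢n     = IsUnit-prodℕ⁻ n (IsUnit-*⁻ˡ u) r (ℕ.≤∧≢⇒< (ℕ.≤-pred r<1+n) r≢n)

module Kronecker {c ℓ} (B : CommutativeRing c ℓ) where
  open CommutativeRing B hiding (zero)
  open RingOps B using (δ)
  open import Algebra.Properties.Semiring.Sum semiring using (sum; sum-cong-≋; sum-replicate-zero)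
  open import Relation.Binary.Reasoning.Setoid setoid

  δ-≡ : ∀ {m n} → m ≡ n → δ m n ≈ 1#
  δ-≡ {zero}  ≡.refl = refl
  δ-≡ {suc m} ≡.refl = δ-≡ {m} ≡.refl

  δ-≢ : ∀ {m n} → m ≢ n → δ m n ≈ 0#
  δ-≢ {zero}  {zero}  m≢n = ⊥-elim (m≢n ≡.refl)
  δ-≢ {zero}  {suc n} _   = refl
  δ-≢ {suc m} {zero}  _   = refl
  δ-≢ {suc m} {suc n} m≢n = δ-≢ (λ m≡n → m≢n (≡.cong suc m≡n))

  δ-sym : ∀ m n → δ m n ≡ δ n m
  δ-sym zero    zero    = ≡.refl
  δ-sym zero    (suc n) = ≡.refl
  δ-sym (suc m) zero    = ≡.refl
  δ-sym (suc m) (suc n) = δ-sym m n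

  δ-*-≡ : ∀ m n → m ≡ n → ∀ x → δ m n * x ≈ x
  δ-*-≡ m n m≡n x = trans (*-congʳ (δ-≡ m≡n)) (*-identityˡ x)

  δ-*-≢ : ∀ m n → m ≢ n → ∀ x → δ m n * x ≈ 0#
  δ-*-≢ m n m≢n x = trans (*-congʳ (δ-≢ m≢n)) (zeroˡ x)

  δ-*-cong : ∀ m n {z z′} → (m ≡ n → z ≈ z′) → δ m n * z ≈ δ m n * z′
  δ-*-cong m n z≈z′ with m ℕ.≟ n
  ... | yes m≡n = *-congˡ (z≈z′ m≡n)
  ... | no  m≢n = trans (δ-*-≢ m n m≢n _) (sym (δ-*-≢ m n m≢n _))

  δ²-*-cong : ∀ m n m′ n′ {z z′} → (m ≡ n → m′ ≡ n′ → z ≈ z′) →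
              (δ m n * δ m′ n′) * z ≈ (δ m n * δ m′ n′) * z′
  δ²-*-cong m n m′ n′ z≈z′ =
    trans (*-assoc _ _ _) (trans (δ-*-cong m n (λ e → δ-*-cong m′ n′ (z≈z′ e))) (sym (*-assoc _ _ _)))

  δ-+-split : ∀ u v a c {z} → (a < u ⊎ c < v → z ≈ 0#) → δ (u ℕ.+ v) (a ℕ.+ c) * z ≈ (δ u a * δ v c) * z
  δ-+-split u v a c {z} z≈0 with u ℕ.+ v ℕ.≟ a ℕ.+ c
  ... | no sum≢ = trans (δ-*-≢ _ _ sum≢ z) (sym (trans (*-congʳ δu*δv≈0) (zeroˡ z)))
    where
    δu*δv≈0 : δ u a * δ v c ≈ 0#
    δu*δv≈0 with u ℕ.≟ a
    ... | no  u≢a    = trans (*-congʳ (δ-≢ u≢a)) (zeroˡ _)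
    ... | yes ≡.refl = trans (*-congˡ (δ-≢ (λ v≡c → sum≢ (≡.cong (u ℕ.+_) v≡c)))) (zeroʳ _)
  ... | yes sum≡ with +-≡-split sum≡
  ...   | inj₁ (u≡a , v≡c) = begin
    δ (u ℕ.+ v) (a ℕ.+ c) * z  ≈⟨ δ-*-≡ _ _ sum≡ z ⟩
    z                          ≈⟨ *-identityˡ z ⟨
    1# * z                     ≈⟨ *-congʳ (trans (*-cong (δ-≡ u≡a) (δ-≡ v≡c)) (*-identityˡ 1#)) ⟨
    (δ u a * δ v c) * z        ∎
  ...   | inj₂ above = trans (*-congˡ (z≈0 above)) (trans (zeroʳ _)
                         (sym (trans (*-congˡ (z≈0 above)) (zeroʳ _))))

  δ-+-above : ∀ u v n a c {z} → a ℕ.+ c < n → (a < u ⊎ c < v → z ≈ 0#) → δ (u ℕ.+ v) n * z ≈ 0#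
  δ-+-above u v n a c {z} a+c<n z≈0 with u ℕ.+ v ℕ.≟ n
  ... | yes ≡.refl = trans (*-congˡ (z≈0 (+-<-split a+c<n))) (zeroʳ _)
  ... | no  sum≢n  = δ-*-≢ _ _ sum≢n z

  sum-zero : ∀ n {g : Fin n → Carrier} → (∀ i → g i ≈ 0#) → sum g ≈ 0#
  sum-zero n g≈0 = trans (sum-cong-≋ g≈0) (sum-replicate-zero n)

  sum-δ-toℕ : ∀ {n} (x : Fin n) (g : Fin n → Carrier) → sum (λ y → δ (toℕ y) (toℕ x) * g y) ≈ g x
  sum-δ-toℕ {suc n} Fin.zero g = begin
    δ 0 0 * g Fin.zero + sum {n} (λ y → δ (suc (toℕ y)) 0 * g (Fin.suc y))
      ≈⟨ +-cong (δ-*-≡ 0 0 ≡.refl _) (sum-zero n (λ y → δ-*-≢ (suc (toℕ y)) 0 (λ ()) _)) ⟩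
    g Fin.zero + 0# ≈⟨ +-identityʳ _ ⟩
    g Fin.zero      ∎
  sum-δ-toℕ {suc n} (Fin.suc x) g = begin
    δ 0 (suc (toℕ x)) * g Fin.zero + sum {n} (λ y → δ (toℕ y) (toℕ x) * g (Fin.suc y))
      ≈⟨ +-cong (δ-*-≢ 0 (suc (toℕ x)) (λ ()) _) (sum-δ-toℕ x (λ y → g (Fin.suc y))) ⟩
    0# + g (Fin.suc x) ≈⟨ +-identityˡ _ ⟩
    g (Fin.suc x)      ∎

  sum-δ : ∀ n m (h : ℕ → Carrier) → (n ≤ m → h m ≈ 0#) → sum {n} (λ x → δ m (toℕ x) * h (toℕ x)) ≈ h m
  sum-δ zero    m       h h≈0 = sym (h≈0 z≤n)
  sum-δ (suc n) zero    h h≈0 = begin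
    δ 0 0 * h 0 + sum {n} (λ x → δ 0 (suc (toℕ x)) * h (suc (toℕ x)))
      ≈⟨ +-cong (δ-*-≡ 0 0 ≡.refl _) (sum-zero n (λ x → δ-*-≢ 0 (suc (toℕ x)) (λ ()) _)) ⟩
    h 0 + 0# ≈⟨ +-identityʳ _ ⟩
    h 0      ∎
  sum-δ (suc n) (suc m) h h≈0 = begin
    δ (suc m) 0 * h 0 + sum {n} (λ x → δ m (toℕ x) * h (suc (toℕ x)))
      ≈⟨ +-cong (δ-*-≢ (suc m) 0 (λ ()) _) (sum-δ n m (λ k → h (suc k)) (λ n≤m → h≈0 (s≤s n≤m))) ⟩
    0# + h (suc m) ≈⟨ +-identityˡ _ ⟩
    h (suc m)      ∎

module TruncatedPolynomials {c ℓ} (B : CommutativeRing c ℓ) (p : ℕ) .{{_ : NonZero p}} where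
  open CommutativeRing B hiding (zero)
  open RingOps B using (δ; fromℕ; pow)
  open Kronecker B
  import Algebra.Properties.Semiring.Sum semiring as FinSum
  open FinSum using (sum)
  open import Algebra.Properties.CommutativeSemigroup *-commutativeSemigroup using (interchange)
  open import Relation.Binary.Reasoning.Setoid setoid
  open import Algebra.Solver.Ring.NaturalCoefficients.Default commutativeSemiring

  infixr 5 _⊠_
  data Shape : Set where
    var : Shape
    _⊠_ : Shape → Shape → Shape

  Exponent : Shape → Set
  Exponent var     = Fin p
  Exponent (U ⊠ V) = Exponent U × Exponent V

  ∑ : (U : Shape) → (Exponent U → Carrier) → Carrier
  ∑ var     g = sum g
  ∑ (U ⊠ V) g = ∑ U (λ x → ∑ V (λ y → g (x , y)))

  ∑-cong : ∀ U {g h : Exponent U → Carrier} → (∀ x → g x ≈ h x) → ∑ U g ≈ ∑ U h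
  ∑-cong var     g≈h = FinSum.sum-cong-≋ g≈h
  ∑-cong (U ⊠ V) g≈h = ∑-cong U (λ x → ∑-cong V (λ y → g≈h (x , y)))

  ∑-distrib-+ : ∀ U (g h : Exponent U → Carrier) → ∑ U (λ x → g x + h x) ≈ ∑ U g + ∑ U h
  ∑-distrib-+ var     g h = FinSum.∑-distrib-+ g h
  ∑-distrib-+ (U ⊠ V) g h = trans (∑-cong U (λ x → ∑-distrib-+ V _ _)) (∑-distrib-+ U _ _)

  *-distribˡ-∑ : ∀ U a (g : Exponent U → Carrier) → a * ∑ U g ≈ ∑ U (λ x → a * g x)
  *-distribˡ-∑ var     a g = FinSum.*-distribˡ-sum a g
  *-distribˡ-∑ (U ⊠ V) a g = trans (*-distribˡ-∑ U a _) (∑-cong U (λ x → *-distribˡ-∑ V a _))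

  *-distribʳ-∑ : ∀ U a (g : Exponent U → Carrier) → ∑ U g * a ≈ ∑ U (λ x → g x * a)
  *-distribʳ-∑ var     a g = FinSum.*-distribʳ-sum a g
  *-distribʳ-∑ (U ⊠ V) a g = trans (*-distribʳ-∑ U a _) (∑-cong U (λ x → *-distribʳ-∑ V a _))

  ∑-zero : ∀ U {g : Exponent U → Carrier} → (∀ x → g x ≈ 0#) → ∑ U g ≈ 0#
  ∑-zero var     g≈0 = sum-zero p g≈0
  ∑-zero (U ⊠ V) g≈0 = ∑-zero U (λ x → ∑-zero V (λ y → g≈0 (x , y)))

  ∑-comm : ∀ U V (g : Exponent U → Exponent V → Carrier) →
           ∑ U (λ x → ∑ V (g x)) ≈ ∑ V (λ y → ∑ U (λ x → g x y))
  ∑-comm var       var       g = FinSum.∑-comm g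
  ∑-comm var       (V₁ ⊠ V₂) g = trans (∑-comm var V₁ _) (∑-cong V₁ (λ y₁ → ∑-comm var V₂ _))
  ∑-comm (U₁ ⊠ U₂) V         g = trans (∑-cong U₁ (λ x₁ → ∑-comm U₂ V _)) (∑-comm U₁ V _)

  ∑-comm-sum : ∀ U n (G : Fin n → Exponent U → Carrier) → ∑ U (λ x → sum (λ k → G k x)) ≈ sum (λ k → ∑ U (G k))
  ∑-comm-sum var     n G = FinSum.∑-comm (λ x k → G k x)
  ∑-comm-sum (U ⊠ V) n G = trans (∑-cong U (λ x → ∑-comm-sum V n _)) (∑-comm-sum U n _)

  ∑-*-∑ : ∀ U V (g : Exponent U → Carrier) (h : Exponent V → Carrier) →
          ∑ U (λ x → ∑ V (λ y → g x * h y)) ≈ ∑ U g * ∑ V h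
  ∑-*-∑ U V g h = trans (∑-cong U (λ x → sym (*-distribˡ-∑ V (g x) h))) (sym (*-distribʳ-∑ U _ g))

  0ₑ : ∀ U → Exponent U
  0ₑ var     = fromℕ< (ℕ.>-nonZero⁻¹ p)
  0ₑ (U ⊠ V) = 0ₑ U , 0ₑ V

  toℕ-0ₑ : toℕ (0ₑ var) ≡ 0
  toℕ-0ₑ = Fin.toℕ-fromℕ< _

  ≟ₑ : ∀ U → DecidableEquality (Exponent U)
  ≟ₑ var     = Fin._≟_
  ≟ₑ (U ⊠ V) = ≡-dec (≟ₑ U) (≟ₑ V)

  δ-≥p : ∀ k (x : Fin p) → p ≤ k → δ k (toℕ x) ≈ 0#
  δ-≥p k x p≤k = δ-≢ (λ k≡x → ℕ.<⇒≱ (Fin.toℕ<n x) (≡.subst (p ≤_) k≡x p≤k))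

  δ= : ∀ U → Exponent U → Exponent U → Carrier
  δ= var     x y = δ (toℕ x) (toℕ y)
  δ= (U ⊠ V) (x , x′) (y , y′) = δ= U x y * δ= V x′ y′

  δ=-sym : ∀ U x y → δ= U x y ≡ δ= U y x
  δ=-sym var     x y = δ-sym (toℕ x) (toℕ y)
  δ=-sym (U ⊠ V) (x , x′) (y , y′) = ≡.cong₂ _*_ (δ=-sym U x y) (δ=-sym V x′ y′)

  δ=-refl : ∀ U x → δ= U x x ≈ 1#
  δ=-refl var     x       = δ-≡ {toℕ x} ≡.refl
  δ=-refl (U ⊠ V) (x , y) = trans (*-cong (δ=-refl U x) (δ=-refl V y)) (*-identityˡ 1#)

  δ=-≢ : ∀ U {x y} → x ≢ y → δ= U x y ≈ 0#
  δ=-≢ var     x≢y = δ-≢ (λ e → x≢y (Fin.toℕ-injective e))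
  δ=-≢ (U ⊠ V) {x , x′} {y , y′} ne with ≟ₑ U x y
  ... | no x≢y     = trans (*-congʳ (δ=-≢ U x≢y)) (zeroˡ _)
  ... | yes ≡.refl = trans (*-congˡ (δ=-≢ V (λ e → ne (≡.cong (x ,_) e)))) (zeroʳ _)

  ∑-δ= : ∀ U x (g : Exponent U → Carrier) → ∑ U (λ y → δ= U y x * g y) ≈ g x
  ∑-δ= var     x        g = sum-δ-toℕ x g
  ∑-δ= (U ⊠ V) (x , x′) g = begin
    ∑ U (λ y → ∑ V (λ y′ → (δ= U y x * δ= V y′ x′) * g (y , y′)))
      ≈⟨ ∑-cong U (λ y → trans (∑-cong V (λ y′ → *-assoc _ _ _)) (sym (*-distribˡ-∑ V _ _))) ⟩
    ∑ U (λ y → δ= U y x * ∑ V (λ y′ → δ= V y′ x′ * g (y , y′)))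
      ≈⟨ ∑-cong U (λ y → *-congˡ (∑-δ= V x′ _)) ⟩
    ∑ U (λ y → δ= U y x * g (y , x′))
      ≈⟨ ∑-δ= U x _ ⟩
    g (x , x′) ∎

  ∑-δ=ʳ : ∀ U x (g : Exponent U → Carrier) → ∑ U (λ y → g y * δ= U x y) ≈ g x
  ∑-δ=ʳ U x g = trans (∑-cong U (λ y → trans (*-comm _ _) (*-congʳ (reflexive (δ=-sym U x y))))) (∑-δ= U x g)

  -- An exponent sum x + y that reaches p matches no z: this is how x_i ^ p = 0 is encoded.
  δ+ : ∀ U → Exponent U → Exponent U → Exponent U → Carrier
  δ+ var     x y z = δ (toℕ x ℕ.+ toℕ y) (toℕ z)
  δ+ (U ⊠ V) (x , x′) (y , y′) (z , z′) = δ+ U x y z * δ+ V x′ y′ z′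

  δ+-comm : ∀ U x y z → δ+ U x y z ≡ δ+ U y x z
  δ+-comm var     x y z = ≡.cong (λ k → δ k (toℕ z)) (ℕ.+-comm (toℕ x) (toℕ y))
  δ+-comm (U ⊠ V) (x , x′) (y , y′) (z , z′) = ≡.cong₂ _*_ (δ+-comm U x y z) (δ+-comm V x′ y′ z′)

  δ+-identityˡ : ∀ U y z → δ+ U (0ₑ U) y z ≡ δ= U y z
  δ+-identityˡ var     y z = ≡.cong (λ k → δ (k ℕ.+ toℕ y) (toℕ z)) toℕ-0ₑ
  δ+-identityˡ (U ⊠ V) (y , y′) (z , z′) = ≡.cong₂ _*_ (δ+-identityˡ U y z) (δ+-identityˡ V y′ z′)

  δ+-zero : ∀ U x y → δ+ U x y (0ₑ U) ≈ δ= U x (0ₑ U) * δ= U y (0ₑ U)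
  δ+-zero var x y rewrite toℕ-0ₑ with toℕ x
  ... | zero  = sym (*-identityˡ _)
  ... | suc _ = sym (zeroˡ _)
  δ+-zero (U ⊠ V) (x , x′) (y , y′) = trans (*-cong (δ+-zero U x y) (δ+-zero V x′ y′)) (interchange _ _ _ _)

  δ+-assoc : ∀ U a b c m → ∑ U (λ x → δ+ U a b x * δ+ U x c m) ≈ ∑ U (λ y → δ+ U b c y * δ+ U a y m)
  δ+-assoc var a b c m = begin
    sum {p} (λ x → δ (toℕ a ℕ.+ toℕ b) (toℕ x) * δ (toℕ x ℕ.+ toℕ c) (toℕ m))
      ≈⟨ sum-δ p (toℕ a ℕ.+ toℕ b) (λ k → δ (k ℕ.+ toℕ c) (toℕ m))
           (λ p≤ → δ-≥p _ m (ℕ.≤-trans p≤ (ℕ.m≤m+n _ _))) ⟩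
    δ (toℕ a ℕ.+ toℕ b ℕ.+ toℕ c) (toℕ m)
      ≡⟨ ≡.cong (λ k → δ k (toℕ m)) (ℕ.+-assoc (toℕ a) (toℕ b) (toℕ c)) ⟩
    δ (toℕ a ℕ.+ (toℕ b ℕ.+ toℕ c)) (toℕ m)
      ≈⟨ sum-δ p (toℕ b ℕ.+ toℕ c) (λ k → δ (toℕ a ℕ.+ k) (toℕ m))
           (λ p≤ → δ-≥p _ m (ℕ.≤-trans p≤ (ℕ.m≤n+m _ (toℕ a)))) ⟨
    sum {p} (λ y → δ (toℕ b ℕ.+ toℕ c) (toℕ y) * δ (toℕ a ℕ.+ toℕ y) (toℕ m)) ∎
  δ+-assoc (U ⊠ V) (a , a′) (b , b′) (c , c′) (m , m′) = begin
    ∑ U (λ x → ∑ V (λ x′ → (δ+ U a b x * δ+ V a′ b′ x′) * (δ+ U x c m * δ+ V x′ c′ m′)))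
      ≈⟨ ∑-cong U (λ x → ∑-cong V (λ x′ → interchange _ _ _ _)) ⟩
    ∑ U (λ x → ∑ V (λ x′ → (δ+ U a b x * δ+ U x c m) * (δ+ V a′ b′ x′ * δ+ V x′ c′ m′)))
      ≈⟨ ∑-*-∑ U V _ _ ⟩
    ∑ U (λ x → δ+ U a b x * δ+ U x c m) * ∑ V (λ x′ → δ+ V a′ b′ x′ * δ+ V x′ c′ m′)
      ≈⟨ *-cong (δ+-assoc U a b c m) (δ+-assoc V a′ b′ c′ m′) ⟩
    ∑ U (λ y → δ+ U b c y * δ+ U a y m) * ∑ V (λ y′ → δ+ V b′ c′ y′ * δ+ V a′ y′ m′)
      ≈⟨ ∑-*-∑ U V _ _ ⟨
    ∑ U (λ y → ∑ V (λ y′ → (δ+ U b c y * δ+ U a y m) * (δ+ V b′ c′ y′ * δ+ V a′ y′ m′)))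
      ≈⟨ ∑-cong U (λ y → ∑-cong V (λ y′ → interchange _ _ _ _)) ⟩
    ∑ U (λ y → ∑ V (λ y′ → (δ+ U b c y * δ+ V b′ c′ y′) * (δ+ U a y m * δ+ V a′ y′ m′))) ∎

  -- Poly U is B[x_i | i a leaf of U]/(x_i ^ p), each element given by its coefficient function.
  Poly : Shape → Set c
  Poly U = Exponent U → Carrier

  infix 4 _≋_
  _≋_ : ∀ {U} → Poly U → Poly U → Set ℓ
  u ≋ v = ∀ x → u x ≈ v x

  basis : ∀ U → Exponent U → Poly U
  basis U x y = δ= U y x

  0ᴾ : ∀ {U} → Poly U
  0ᴾ _ = 0#

  1ᴾ : ∀ U → Poly U
  1ᴾ U = basis U (0ₑ U)

  infixl 6 _+ᴾ_
  _+ᴾ_ : ∀ {U} → Poly U → Poly U → Poly U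
  (u +ᴾ v) x = u x + v x

  infixr 7 _•_
  _•_ : ∀ {U} → Carrier → Poly U → Poly U
  (a • u) x = a * u x

  polyMul : ∀ U → Poly U → Poly U → Poly U
  polyMul U u v z = ∑ U (λ x → ∑ U (λ y → δ+ U x y z * (u x * v y)))

  infixl 7 polyMul
  syntax polyMul U u v = u ·[ U ] v

  ·-cong : ∀ U {u u′ v v′} → u ≋ u′ → v ≋ v′ → u ·[ U ] v ≋ u′ ·[ U ] v′
  ·-cong U u≋u′ v≋v′ z = ∑-cong U (λ x → ∑-cong U (λ y → *-congˡ (*-cong (u≋u′ x) (v≋v′ y))))

  ·-comm : ∀ U u v → u ·[ U ] v ≋ v ·[ U ] u
  ·-comm U u v z = begin
    ∑ U (λ x → ∑ U (λ y → δ+ U x y z * (u x * v y)))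
      ≈⟨ ∑-cong U (λ x → ∑-cong U (λ y → *-cong (reflexive (δ+-comm U x y z)) (*-comm _ _))) ⟩
    ∑ U (λ x → ∑ U (λ y → δ+ U y x z * (v y * u x)))
      ≈⟨ ∑-comm U U _ ⟩
    ∑ U (λ y → ∑ U (λ x → δ+ U y x z * (v y * u x))) ∎

  ·-identityˡ : ∀ U v → 1ᴾ U ·[ U ] v ≋ v
  ·-identityˡ U v z = begin
    ∑ U (λ x → ∑ U (λ y → δ+ U x y z * (δ= U x (0ₑ U) * v y)))
      ≈⟨ ∑-comm U U _ ⟩
    ∑ U (λ y → ∑ U (λ x → δ+ U x y z * (δ= U x (0ₑ U) * v y)))
      ≈⟨ ∑-cong U (λ y → ∑-cong U (λ x → solve 3 (λ a b c → a :* (b :* c) := b :* (a :* c)) refl _ _ _)) ⟩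
    ∑ U (λ y → ∑ U (λ x → δ= U x (0ₑ U) * (δ+ U x y z * v y)))
      ≈⟨ ∑-cong U (λ y → ∑-δ= U (0ₑ U) _) ⟩
    ∑ U (λ y → δ+ U (0ₑ U) y z * v y)
      ≈⟨ ∑-cong U (λ y → *-congʳ (reflexive (δ+-identityˡ U y z))) ⟩
    ∑ U (λ y → δ= U y z * v y)
      ≈⟨ ∑-δ= U z v ⟩
    v z ∎

  ·-distribʳ : ∀ U w u v → (u +ᴾ v) ·[ U ] w ≋ u ·[ U ] w +ᴾ v ·[ U ] w
  ·-distribʳ U w u v z = begin
    ∑ U (λ x → ∑ U (λ y → δ+ U x y z * ((u x + v x) * w y)))
      ≈⟨ ∑-cong U (λ x → ∑-cong U (λ y → trans (*-congˡ (distribʳ _ _ _)) (distribˡ _ _ _))) ⟩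
    ∑ U (λ x → ∑ U (λ y → δ+ U x y z * (u x * w y) + δ+ U x y z * (v x * w y)))
      ≈⟨ ∑-distrib-+ (U ⊠ U) _ _ ⟩
    (u ·[ U ] w) z + (v ·[ U ] w) z ∎

  ·-zeroˡ : ∀ U u → 0ᴾ ·[ U ] u ≋ 0ᴾ
  ·-zeroˡ U u z = ∑-zero (U ⊠ U) (λ _ → trans (*-congˡ (zeroˡ _)) (zeroʳ _))

  ·-assoc : ∀ U u v w → (u ·[ U ] v) ·[ U ] w ≋ u ·[ U ] (v ·[ U ] w)
  ·-assoc U u v w m = begin
    ((u ·[ U ] v) ·[ U ] w) m
      ≈⟨ expandˡ ⟩
    ∑ U (λ a → ∑ U (λ b → ∑ U (λ c → ∑ U (λ x → δ+ U a b x * δ+ U x c m) * (u a * (v b * w c)))))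
      ≈⟨ ∑-cong (U ⊠ U ⊠ U) (λ { (a , b , c) → *-congʳ (δ+-assoc U a b c m) }) ⟩
    ∑ U (λ a → ∑ U (λ b → ∑ U (λ c → ∑ U (λ y → δ+ U b c y * δ+ U a y m) * (u a * (v b * w c)))))
      ≈⟨ expandʳ ⟨
    (u ·[ U ] (v ·[ U ] w)) m ∎
    where
    expandˡ : ((u ·[ U ] v) ·[ U ] w) m ≈
              ∑ U (λ a → ∑ U (λ b → ∑ U (λ c → ∑ U (λ x → δ+ U a b x * δ+ U x c m) * (u a * (v b * w c)))))
    expandˡ = begin
      ∑ U (λ x → ∑ U (λ c → δ+ U x c m * (∑ U (λ a → ∑ U (λ b → δ+ U a b x * (u a * v b))) * w c)))
        ≈⟨ ∑-cong (U ⊠ U) (λ { (x , c) → trans (*-congˡ (*-distribʳ-∑ (U ⊠ U) _ _))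
             (trans (*-distribˡ-∑ (U ⊠ U) _ _) (∑-cong (U ⊠ U) (λ { (a , b) →
               solve 5 (λ d₁ d₂ ua vb wc → d₁ :* ((d₂ :* (ua :* vb)) :* wc) := (d₂ :* d₁) :* (ua :* (vb :* wc)))
                 refl (δ+ U x c m) (δ+ U a b x) (u a) (v b) (w c) }))) }) ⟩
      ∑ U (λ x → ∑ U (λ c → ∑ U (λ a → ∑ U (λ b → (δ+ U a b x * δ+ U x c m) * (u a * (v b * w c))))))
        ≈⟨ ∑-comm (U ⊠ U) (U ⊠ U) _ ⟩
      ∑ U (λ a → ∑ U (λ b → ∑ U (λ x → ∑ U (λ c → (δ+ U a b x * δ+ U x c m) * (u a * (v b * w c))))))
        ≈⟨ ∑-cong (U ⊠ U) (λ _ → ∑-comm U U _) ⟩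
      ∑ U (λ a → ∑ U (λ b → ∑ U (λ c → ∑ U (λ x → (δ+ U a b x * δ+ U x c m) * (u a * (v b * w c))))))
        ≈⟨ ∑-cong (U ⊠ U ⊠ U) (λ _ → sym (*-distribʳ-∑ U _ _)) ⟩
      ∑ U (λ a → ∑ U (λ b → ∑ U (λ c → ∑ U (λ x → δ+ U a b x * δ+ U x c m) * (u a * (v b * w c))))) ∎
    expandʳ : (u ·[ U ] (v ·[ U ] w)) m ≈
              ∑ U (λ a → ∑ U (λ b → ∑ U (λ c → ∑ U (λ y → δ+ U b c y * δ+ U a y m) * (u a * (v b * w c)))))
    expandʳ = begin
      ∑ U (λ a → ∑ U (λ y → δ+ U a y m * (u a * ∑ U (λ b → ∑ U (λ c → δ+ U b c y * (v b * w c))))))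
        ≈⟨ ∑-cong (U ⊠ U) (λ { (a , y) → trans (*-congˡ (*-distribˡ-∑ (U ⊠ U) _ _))
             (trans (*-distribˡ-∑ (U ⊠ U) _ _) (∑-cong (U ⊠ U) (λ { (b , c) →
               solve 5 (λ d₁ d₂ ua vb wc → d₁ :* (ua :* (d₂ :* (vb :* wc))) := (d₂ :* d₁) :* (ua :* (vb :* wc)))
                 refl (δ+ U a y m) (δ+ U b c y) (u a) (v b) (w c) }))) }) ⟩
      ∑ U (λ a → ∑ U (λ y → ∑ U (λ b → ∑ U (λ c → (δ+ U b c y * δ+ U a y m) * (u a * (v b * w c))))))
        ≈⟨ ∑-cong U (λ _ → ∑-comm U (U ⊠ U) _) ⟩
      ∑ U (λ a → ∑ U (λ b → ∑ U (λ c → ∑ U (λ y → (δ+ U b c y * δ+ U a y m) * (u a * (v b * w c))))))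
        ≈⟨ ∑-cong (U ⊠ U ⊠ U) (λ _ → sym (*-distribʳ-∑ U _ _)) ⟩
      ∑ U (λ a → ∑ U (λ b → ∑ U (λ c → ∑ U (λ y → δ+ U b c y * δ+ U a y m) * (u a * (v b * w c))))) ∎

  ·-isCommutativeMonoid : ∀ U → IsCommutativeMonoid (_≋_ {U}) (polyMul U) (1ᴾ U)
  ·-isCommutativeMonoid U = record
    { isMonoid = record
      { isSemigroup = record
        { isMagma = record { isEquivalence = Pointwise.isEquivalence isEquivalence ; ∙-cong = ·-cong U }
        ; assoc   = ·-assoc U }
      ; identity = ·-identityˡ U , λ u z → trans (·-comm U u (1ᴾ U) z) (·-identityˡ U u z) }
    ; comm = ·-comm U }
    where module Pointwise = Algebra.Construct.Pointwise (Exponent U)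

  Poly-commutativeSemiring : Shape → CommutativeSemiring c ℓ
  Poly-commutativeSemiring U = record
    { isCommutativeSemiring = IsCommutativeSemiringˡ.isCommutativeSemiring (record
      { +-isCommutativeMonoid = Pointwise.isCommutativeMonoid +-isCommutativeMonoid
      ; *-isCommutativeMonoid = ·-isCommutativeMonoid U
      ; distribʳ = ·-distribʳ U
      ; zeroˡ = ·-zeroˡ U }) }
    where module Pointwise = Algebra.Construct.Pointwise (Exponent U)

  module PolyExp (U : Shape) = Algebra.Properties.Semiring.Exp (CommutativeSemiring.semiring (Poly-commutativeSemiring U))

  polyPow : ∀ U → Poly U → ℕ → Poly U
  polyPow U = PolyExp._^_ U

  infixr 8 polyPow
  syntax polyPow U u n = u ^[ U ] n

  ^-cong : ∀ U n {u v} → u ≋ v → u ^[ U ] n ≋ v ^[ U ] n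
  ^-cong U n = PolyExp.^-congˡ U n

  ^-homo-· : ∀ U u m n → u ^[ U ] (m ℕ.+ n) ≋ u ^[ U ] m ·[ U ] u ^[ U ] n
  ^-homo-· U = PolyExp.^-homo-* U

  •-· : ∀ U a u v → (a • u) ·[ U ] v ≋ a • (u ·[ U ] v)
  •-· U a u v z = trans
    (∑-cong (U ⊠ U) (λ _ → solve 4 (λ d a′ ux vy → d :* ((a′ :* ux) :* vy) := a′ :* (d :* (ux :* vy))) refl _ a _ _))
    (sym (*-distribˡ-∑ (U ⊠ U) a _))

  •-^ : ∀ U a u n → (a • u) ^[ U ] n ≋ pow a n • u ^[ U ] n
  •-^ U a u zero    x = sym (*-identityˡ _)
  •-^ U a u (suc n) x = begin
    ((a • u) ·[ U ] (a • u) ^[ U ] n) x                  ≈⟨ ·-cong U {a • u} (λ _ → refl) (•-^ U a u n) x ⟩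
    ((a • u) ·[ U ] (pow a n • u ^[ U ] n)) x  ≈⟨ •-· U a u _ x ⟩
    a * (u ·[ U ] (pow a n • u ^[ U ] n)) x
      ≈⟨ *-congˡ (trans (·-comm U u _ x) (trans (•-· U _ _ u x) (*-congˡ (·-comm U _ u x)))) ⟩
    a * (pow a n * (u ·[ U ] u ^[ U ] n) x)    ≈⟨ *-assoc _ _ _ ⟨
    pow a (suc n) * (u ^[ U ] suc n) x         ∎

  1ᴾ-^ : ∀ U n → 1ᴾ U ^[ U ] n ≋ 1ᴾ U
  1ᴾ-^ U zero    x = refl
  1ᴾ-^ U (suc n) x = trans (·-identityˡ U _ x) (1ᴾ-^ U n x)

  ·-at-0ₑ : ∀ U u v → (u ·[ U ] v) (0ₑ U) ≈ u (0ₑ U) * v (0ₑ U)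
  ·-at-0ₑ U u v = begin
    ∑ U (λ x → ∑ U (λ y → δ+ U x y (0ₑ U) * (u x * v y)))
      ≈⟨ ∑-cong (U ⊠ U) (λ { (x , y) → trans (*-congʳ (δ+-zero U x y))
           (solve 4 (λ dx dy ux vy → (dx :* dy) :* (ux :* vy) := dx :* ux :* (dy :* vy)) refl _ _ _ _) }) ⟩
    ∑ U (λ x → ∑ U (λ y → δ= U x (0ₑ U) * u x * (δ= U y (0ₑ U) * v y)))
      ≈⟨ ∑-*-∑ U U _ _ ⟩
    ∑ U (λ x → δ= U x (0ₑ U) * u x) * ∑ U (λ y → δ= U y (0ₑ U) * v y)
      ≈⟨ *-cong (∑-δ= U (0ₑ U) u) (∑-δ= U (0ₑ U) v) ⟩
    u (0ₑ U) * v (0ₑ U) ∎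

  ^-at-0ₑ : ∀ U u n → u (0ₑ U) ≈ 1# → (u ^[ U ] n) (0ₑ U) ≈ 1#
  ^-at-0ₑ U u zero    u0≈1 = δ=-refl U (0ₑ U)
  ^-at-0ₑ U u (suc n) u0≈1 = trans (·-at-0ₑ U u _) (trans (*-cong u0≈1 (^-at-0ₑ U u n u0≈1)) (*-identityˡ 1#))

  module PolySum U = Algebra.Properties.Semiring.Sum (CommutativeSemiring.semiring (Poly-commutativeSemiring U))
  module PolyMult U = Algebra.Properties.Semiring.Mult (CommutativeSemiring.semiring (Poly-commutativeSemiring U))

  ×ᴾ-at : ∀ U n (u : Poly U) x → PolyMult._×_ U n u x ≈ fromℕ n * u x
  ×ᴾ-at U zero    u x = sym (zeroˡ _)
  ×ᴾ-at U (suc n) u x = trans (+-cong (sym (*-identityˡ _)) (×ᴾ-at U n u x)) (sym (distribʳ _ _ _))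

  sumᴾ-at : ∀ U n (F : Fin n → Poly U) x → PolySum.sum U F x ≈ sum (λ k → F k x)
  sumᴾ-at U zero    F x = refl
  sumᴾ-at U (suc n) F x = +-congˡ (sumᴾ-at U n (λ k → F (Fin.suc k)) x)

  frobenius : Prime p → fromℕ p ≈ 0# → ∀ U u v → (u +ᴾ v) ^[ U ] p ≋ u ^[ U ] p +ᴾ v ^[ U ] p
  frobenius p-prime p≈0 U = FreshmansDream.^-distrib-+ (Poly-commutativeSemiring U) p binomial×≈0
    where
    binomial×≈0 : ∀ k → 0 < k → k < p → ∀ u → PolyMult._×_ U (p C k) u ≋ 0ᴾ
    binomial×≈0 k 0<k k<p u x = trans (×ᴾ-at U (p C k) u x)
      (trans (*-congʳ (Characteristic.fromℕ-binomial≈0 B p-prime p≈0 k 0<k k<p)) (zeroˡ _))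

  var^ : ℕ → Poly var
  var^ a x = δ (toℕ x) a

  var^-0 : var^ 0 ≋ 1ᴾ var
  var^-0 x = reflexive (≡.cong (δ (toℕ x)) (≡.sym toℕ-0ₑ))

  var^-≥p : ∀ a → p ≤ a → var^ a ≋ 0ᴾ
  var^-≥p a p≤a x = trans (reflexive (δ-sym (toℕ x) a)) (δ-≥p a x p≤a)

  ∑-var^ : ∀ a → a < p → ∑ var (var^ a) ≈ 1#
  ∑-var^ a a<p = trans (∑-cong var (λ x → trans (reflexive (δ-sym (toℕ x) a)) (sym (*-identityʳ _))))
    (sum-δ p a (λ _ → 1#) (λ p≤a → ⊥-elim (ℕ.<⇒≱ a<p p≤a)))

  var^-· : ∀ a b → var^ a ·[ var ] var^ b ≋ var^ (a ℕ.+ b)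
  var^-· a b z = begin
    ∑ var (λ x → ∑ var (λ y → δ (toℕ x ℕ.+ toℕ y) (toℕ z) * (δ (toℕ x) a * δ (toℕ y) b)))
      ≈⟨ ∑-cong var (λ x → trans (∑-cong var (λ y →
           trans (solve 3 (λ d dx dy → d :* (dx :* dy) := dx :* (d :* dy)) refl _ _ _)
                 (*-congʳ (reflexive (δ-sym (toℕ x) a))))) (sym (*-distribˡ-∑ var _ _))) ⟩
    ∑ var (λ x → δ a (toℕ x) * ∑ var (λ y → δ (toℕ x ℕ.+ toℕ y) (toℕ z) * δ (toℕ y) b))
      ≈⟨ sum-δ p a (λ k → ∑ var (λ y → δ (k ℕ.+ toℕ y) (toℕ z) * δ (toℕ y) b))
           (λ p≤a → ∑-zero var (λ y → trans (*-congʳ (δ-≥p _ z (ℕ.≤-trans p≤a (ℕ.m≤m+n _ _)))) (zeroˡ _))) ⟩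
    ∑ var (λ y → δ (a ℕ.+ toℕ y) (toℕ z) * δ (toℕ y) b)
      ≈⟨ ∑-cong var (λ y → trans (*-comm _ _) (*-congʳ (reflexive (δ-sym (toℕ y) b)))) ⟩
    ∑ var (λ y → δ b (toℕ y) * δ (a ℕ.+ toℕ y) (toℕ z))
      ≈⟨ sum-δ p b (λ k → δ (a ℕ.+ k) (toℕ z)) (λ p≤b → δ-≥p _ z (ℕ.≤-trans p≤b (ℕ.m≤n+m _ a))) ⟩
    δ (a ℕ.+ b) (toℕ z)
      ≡⟨ δ-sym (a ℕ.+ b) (toℕ z) ⟩
    δ (toℕ z) (a ℕ.+ b) ∎

  infixr 7 _⊗_
  _⊗_ : ∀ {U V} → Poly U → Poly V → Poly (U ⊠ V)
  (a ⊗ b) (x , y) = a x * b y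

  ⊗-cong : ∀ {U V} {a a′ : Poly U} {b b′ : Poly V} → a ≋ a′ → b ≋ b′ → a ⊗ b ≋ a′ ⊗ b′
  ⊗-cong a≋a′ b≋b′ (x , y) = *-cong (a≋a′ x) (b≋b′ y)

  ⊗-zeroˡ : ∀ {U V} {a : Poly U} (b : Poly V) → a ≋ 0ᴾ → a ⊗ b ≋ 0ᴾ
  ⊗-zeroˡ b a≋0 (x , y) = trans (*-congʳ (a≋0 x)) (zeroˡ _)

  ⊗-zeroʳ : ∀ {U V} (a : Poly U) {b : Poly V} → b ≋ 0ᴾ → a ⊗ b ≋ 0ᴾ
  ⊗-zeroʳ a b≋0 (x , y) = trans (*-congˡ (b≋0 y)) (zeroʳ _)

  ·-sliceʳ : ∀ U V (s t : Poly (U ⊠ V)) z z′ →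
             (s ·[ U ⊠ V ] t) (z , z′) ≈
             ∑ V (λ x′ → ∑ V (λ y′ → δ+ V x′ y′ z′ * ((λ x → s (x , x′)) ·[ U ] (λ y → t (y , y′))) z))
  ·-sliceʳ U V s t z z′ = begin
    ∑ U (λ x → ∑ V (λ x′ → ∑ U (λ y → ∑ V (λ y′ → (δ+ U x y z * δ+ V x′ y′ z′) * (s (x , x′) * t (y , y′))))))
      ≈⟨ ∑-cong U (λ x → ∑-comm V U _) ⟩
    ∑ U (λ x → ∑ U (λ y → ∑ V (λ x′ → ∑ V (λ y′ → (δ+ U x y z * δ+ V x′ y′ z′) * (s (x , x′) * t (y , y′))))))
      ≈⟨ ∑-comm (U ⊠ U) (V ⊠ V) _ ⟩
    ∑ V (λ x′ → ∑ V (λ y′ → ∑ U (λ x → ∑ U (λ y → (δ+ U x y z * δ+ V x′ y′ z′) * (s (x , x′) * t (y , y′))))))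
      ≈⟨ ∑-cong (V ⊠ V) (λ _ → trans (∑-cong (U ⊠ U) (λ _ →
           solve 3 (λ d d′ st → (d :* d′) :* st := d′ :* (d :* st)) refl _ _ _)) (sym (*-distribˡ-∑ (U ⊠ U) _ _))) ⟩
    ∑ V (λ x′ → ∑ V (λ y′ → δ+ V x′ y′ z′ * ((λ x → s (x , x′)) ·[ U ] (λ y → t (y , y′))) z)) ∎

  ·-sliceˡ : ∀ U V (s t : Poly (U ⊠ V)) z z′ →
             (s ·[ U ⊠ V ] t) (z , z′) ≈
             ∑ U (λ x → ∑ U (λ y → δ+ U x y z * ((λ x′ → s (x , x′)) ·[ V ] (λ y′ → t (y , y′))) z′))
  ·-sliceˡ U V s t z z′ = begin
    ∑ U (λ x → ∑ V (λ x′ → ∑ U (λ y → ∑ V (λ y′ → (δ+ U x y z * δ+ V x′ y′ z′) * (s (x , x′) * t (y , y′))))))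
      ≈⟨ ∑-cong U (λ x → ∑-comm V U _) ⟩
    ∑ U (λ x → ∑ U (λ y → ∑ V (λ x′ → ∑ V (λ y′ → (δ+ U x y z * δ+ V x′ y′ z′) * (s (x , x′) * t (y , y′))))))
      ≈⟨ ∑-cong (U ⊠ U) (λ _ → trans (∑-cong (V ⊠ V) (λ _ → *-assoc _ _ _)) (sym (*-distribˡ-∑ (V ⊠ V) _ _))) ⟩
    ∑ U (λ x → ∑ U (λ y → δ+ U x y z * ((λ x′ → s (x , x′)) ·[ V ] (λ y′ → t (y , y′))) z′)) ∎

  ⊗-· : ∀ U V (a a′ : Poly U) (b b′ : Poly V) → (a ⊗ b) ·[ U ⊠ V ] (a′ ⊗ b′) ≋ (a ·[ U ] a′) ⊗ (b ·[ V ] b′)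
  ⊗-· U V a a′ b b′ (z , z′) = begin
    ((a ⊗ b) ·[ U ⊠ V ] (a′ ⊗ b′)) (z , z′)
      ≈⟨ ·-sliceʳ U V (a ⊗ b) (a′ ⊗ b′) z z′ ⟩
    ∑ V (λ x′ → ∑ V (λ y′ → δ+ V x′ y′ z′ * ((λ x → a x * b x′) ·[ U ] (λ y → a′ y * b′ y′)) z))
      ≈⟨ ∑-cong (V ⊠ V) (λ { (x′ , y′) → trans (*-congˡ (trans (∑-cong (U ⊠ U) (λ _ →
           solve 5 (λ d ax bx ay by → d :* ((ax :* bx) :* (ay :* by)) := (bx :* by) :* (d :* (ax :* ay))) refl _ _ _ _ _))
           (sym (*-distribˡ-∑ (U ⊠ U) _ _)))) (solve 3 (λ d e k → d :* (e :* k) := k :* (d :* e)) refl _ _ _) }) ⟩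
    ∑ V (λ x′ → ∑ V (λ y′ → (a ·[ U ] a′) z * (δ+ V x′ y′ z′ * (b x′ * b′ y′))))
      ≈⟨ sym (*-distribˡ-∑ (V ⊠ V) _ _) ⟩
    ((a ·[ U ] a′) ⊗ (b ·[ V ] b′)) (z , z′) ∎

  ⊗-^ : ∀ U V (a : Poly U) (b : Poly V) n → (a ⊗ b) ^[ U ⊠ V ] n ≋ (a ^[ U ] n) ⊗ (b ^[ V ] n)
  ⊗-^ U V a b zero    x = refl
  ⊗-^ U V a b (suc n) x = trans (·-cong (U ⊠ V) {a ⊗ b} (λ _ → refl) (⊗-^ U V a b n) x) (⊗-· U V a _ b _ x)

  pair : ∀ U → (Exponent U → Carrier) → Poly U → Carrier
  pair U f u = ∑ U (λ x → u x * f x)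

  syntax pair U f u = ⟨ f ∣ u ⟩[ U ]

  pair-cong : ∀ U f {u v} → u ≋ v → ⟨ f ∣ u ⟩[ U ] ≈ ⟨ f ∣ v ⟩[ U ]
  pair-cong U f u≋v = ∑-cong U (λ x → *-congʳ (u≋v x))

  pair-⊗ : ∀ U V (f : Exponent U → Carrier) (g : Exponent V → Carrier) a b →
           ⟨ f ⊗ g ∣ a ⊗ b ⟩[ U ⊠ V ] ≈ ⟨ f ∣ a ⟩[ U ] * ⟨ g ∣ b ⟩[ V ]
  pair-⊗ U V f g a b = trans (∑-cong (U ⊠ V) (λ _ → interchange _ _ _ _)) (∑-*-∑ U V _ _)

  pair-basis : ∀ U f x → ⟨ f ∣ basis U x ⟩[ U ] ≈ f x
  pair-basis U f x = ∑-δ= U x f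

  pair-congˡ : ∀ U {f g} u → (∀ x → f x ≈ g x) → ⟨ f ∣ u ⟩[ U ] ≈ ⟨ g ∣ u ⟩[ U ]
  pair-congˡ U u f≈g = ∑-cong U (λ x → *-congˡ (f≈g x))

  pair-⊗1ᴾ : ∀ U V f t → ⟨ f ⊗ 1ᴾ V ∣ t ⟩[ U ⊠ V ] ≈ ⟨ f ∣ (λ x → t (x , 0ₑ V)) ⟩[ U ]
  pair-⊗1ᴾ U V f t = ∑-cong U (λ x → trans (∑-cong V (λ y →
    solve 3 (λ t′ f′ d → t′ :* (f′ :* d) := d :* (t′ :* f′)) refl (t (x , y)) (f x) (δ= V y (0ₑ V))))
    (∑-δ= V (0ₑ V) (λ y → t (x , y) * f x)))

  pair-1ᴾ⊗ : ∀ U V g t → ⟨ 1ᴾ U ⊗ g ∣ t ⟩[ U ⊠ V ] ≈ ⟨ g ∣ (λ y → t (0ₑ U , y)) ⟩[ V ]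
  pair-1ᴾ⊗ U V g t = trans (∑-comm U V _) (∑-cong V (λ y → trans (∑-cong U (λ x →
    solve 3 (λ t′ d g′ → t′ :* (d :* g′) := d :* (t′ :* g′)) refl (t (x , y)) (δ= U x (0ₑ U)) (g y)))
    (∑-δ= U (0ₑ U) (λ x → t (x , y) * g y))))

  module PolyMonoidMorphisms U V = MonoidMorphisms
    (CommutativeSemiring.*-rawMonoid (Poly-commutativeSemiring U)) (CommutativeSemiring.*-rawMonoid (Poly-commutativeSemiring V))

  IsMultiplicative : ∀ U V → (Poly U → Poly V) → Set (c ⊔ ℓ)
  IsMultiplicative U V = PolyMonoidMorphisms.IsMonoidHomomorphism U V

  mkIsMultiplicative : ∀ U V {φ : Poly U → Poly V} → (∀ {s t} → s ≋ t → φ s ≋ φ t) →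
                       (∀ s t → φ (s ·[ U ] t) ≋ φ s ·[ V ] φ t) → φ (1ᴾ U) ≋ 1ᴾ V → IsMultiplicative U V φ
  mkIsMultiplicative U V φ-cong φ-· φ-1 = record
    { isMagmaHomomorphism = record { isRelHomomorphism = record { cong = φ-cong } ; homo = φ-· }
    ; ε-homo = φ-1 }

  ^-homo : ∀ U V {φ} → IsMultiplicative U V φ → ∀ s n → φ (s ^[ U ] n) ≋ φ s ^[ V ] n
  ^-homo U V φ-mult s zero    = ε-homo
    where open PolyMonoidMorphisms.IsMonoidHomomorphism U V φ-mult
  ^-homo U V {φ} φ-mult s (suc n) x =
    trans (homo s (s ^[ U ] n) x) (·-cong V {φ s} (λ _ → refl) (^-homo U V φ-mult s n) x)
    where open PolyMonoidMorphisms.IsMonoidHomomorphism U V φ-mult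

  basis-· : ∀ U x y z → (basis U x ·[ U ] basis U y) z ≈ δ+ U x y z
  basis-· U x y z = begin
    ∑ U (λ x′ → ∑ U (λ y′ → δ+ U x′ y′ z * (δ= U x′ x * δ= U y′ y)))
      ≈⟨ ∑-cong U (λ x′ → trans (∑-cong U (λ y′ → solve 3 (λ d a b → d :* (a :* b) := a :* (b :* d)) refl _ _ _))
           (sym (*-distribˡ-∑ U _ _))) ⟩
    ∑ U (λ x′ → δ= U x′ x * ∑ U (λ y′ → δ= U y′ y * δ+ U x′ y′ z))
      ≈⟨ ∑-δ= U x _ ⟩
    ∑ U (λ y′ → δ= U y′ y * δ+ U x y′ z)
      ≈⟨ ∑-δ= U y _ ⟩
    δ+ U x y z ∎

  linear : ∀ U V → (Exponent U → Poly V) → Poly U → Poly V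
  linear U V K v w = ∑ U (λ x → v x * K x w)

  IsMultiplicativeOnBasis : ∀ U V → (Exponent U → Poly V) → Set ℓ
  IsMultiplicativeOnBasis U V K = ∀ x y → K x ·[ V ] K y ≋ linear U V K (basis U x ·[ U ] basis U y)

  module _ U V (K : Exponent U → Poly V) where

    linear-cong : ∀ {u v} → u ≋ v → linear U V K u ≋ linear U V K v
    linear-cong u≋v w = ∑-cong U (λ x → *-congʳ (u≋v x))

    linear-basis : ∀ x → linear U V K (basis U x) ≋ K x
    linear-basis x w = ∑-δ= U x (λ y → K y w)

    linear-+ᴾ : ∀ u v → linear U V K (u +ᴾ v) ≋ linear U V K u +ᴾ linear U V K v
    linear-+ᴾ u v w = trans (∑-cong U (λ x → distribʳ _ _ _)) (∑-distrib-+ U _ _)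

    linear-• : ∀ a u → linear U V K (a • u) ≋ a • linear U V K u
    linear-• a u w = trans (∑-cong U (λ x → *-assoc _ _ _)) (sym (*-distribˡ-∑ U a _))

    linear-1ᴾ : K (0ₑ U) ≋ 1ᴾ V → linear U V K (1ᴾ U) ≋ 1ᴾ V
    linear-1ᴾ K0≋1 w = trans (linear-basis (0ₑ U) w) (K0≋1 w)

    pair-linear : ∀ G v → ⟨ G ∣ linear U V K v ⟩[ V ] ≈ ⟨ (λ x → ⟨ G ∣ K x ⟩[ V ]) ∣ v ⟩[ U ]
    pair-linear G v = begin
      ∑ V (λ w → ∑ U (λ x → v x * K x w) * G w)  ≈⟨ ∑-cong V (λ w → *-distribʳ-∑ U (G w) _) ⟩
      ∑ V (λ w → ∑ U (λ x → v x * K x w * G w))  ≈⟨ ∑-comm V U _ ⟩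
      ∑ U (λ x → ∑ V (λ w → v x * K x w * G w))
        ≈⟨ ∑-cong U (λ x → trans (∑-cong V (λ w → *-assoc _ _ _)) (sym (*-distribˡ-∑ V (v x) _))) ⟩
      ∑ U (λ x → v x * ∑ V (λ w → K x w * G w))  ∎

    linear-·-expand : ∀ u v → linear U V K (u ·[ U ] v) ≋
                      λ w → ∑ U (λ x → ∑ U (λ y → (u x * v y) * linear U V K (basis U x ·[ U ] basis U y) w))
    linear-·-expand u v w = begin
      ∑ U (λ z → ∑ U (λ x → ∑ U (λ y → δ+ U x y z * (u x * v y))) * K z w)
        ≈⟨ ∑-cong U (λ z → *-distribʳ-∑ (U ⊠ U) _ _) ⟩
      ∑ U (λ z → ∑ U (λ x → ∑ U (λ y → δ+ U x y z * (u x * v y) * K z w)))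
        ≈⟨ ∑-comm U (U ⊠ U) _ ⟩
      ∑ U (λ x → ∑ U (λ y → ∑ U (λ z → δ+ U x y z * (u x * v y) * K z w)))
        ≈⟨ ∑-cong (U ⊠ U) (λ { (x , y) → trans (∑-cong U (λ z →
             trans (solve 3 (λ d uv k → d :* uv :* k := uv :* (d :* k)) refl _ _ _)
                   (*-congˡ (*-congʳ (sym (basis-· U x y z)))))) (sym (*-distribˡ-∑ U _ _)) }) ⟩
      ∑ U (λ x → ∑ U (λ y → (u x * v y) * linear U V K (basis U x ·[ U ] basis U y) w)) ∎

    linear-·-bilinear : ∀ u v → linear U V K u ·[ V ] linear U V K v ≋
                        λ w → ∑ U (λ x → ∑ U (λ y → (u x * v y) * (K x ·[ V ] K y) w))
    linear-·-bilinear u v w = begin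
      ∑ V (λ w₁ → ∑ V (λ w₂ → δ+ V w₁ w₂ w * (∑ U (λ x → u x * K x w₁) * ∑ U (λ y → v y * K y w₂))))
        ≈⟨ ∑-cong (V ⊠ V) (λ _ → trans (*-congˡ (sym (∑-*-∑ U U _ _))) (*-distribˡ-∑ (U ⊠ U) _ _)) ⟩
      ∑ V (λ w₁ → ∑ V (λ w₂ → ∑ U (λ x → ∑ U (λ y → δ+ V w₁ w₂ w * ((u x * K x w₁) * (v y * K y w₂))))))
        ≈⟨ ∑-comm (V ⊠ V) (U ⊠ U) _ ⟩
      ∑ U (λ x → ∑ U (λ y → ∑ V (λ w₁ → ∑ V (λ w₂ → δ+ V w₁ w₂ w * ((u x * K x w₁) * (v y * K y w₂))))))
        ≈⟨ ∑-cong (U ⊠ U) (λ { (x , y) → trans (∑-cong (V ⊠ V) (λ _ →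
             solve 5 (λ d a k b l → d :* ((a :* k) :* (b :* l)) := (a :* b) :* (d :* (k :* l))) refl _ _ _ _ _))
             (sym (*-distribˡ-∑ (V ⊠ V) _ _)) }) ⟩
      ∑ U (λ x → ∑ U (λ y → (u x * v y) * (K x ·[ V ] K y) w)) ∎

    linear-· : IsMultiplicativeOnBasis U V K → ∀ u v →
               linear U V K (u ·[ U ] v) ≋ linear U V K u ·[ V ] linear U V K v
    linear-· K-mult u v w = begin
      linear U V K (u ·[ U ] v) w
        ≈⟨ linear-·-expand u v w ⟩
      ∑ U (λ x → ∑ U (λ y → (u x * v y) * linear U V K (basis U x ·[ U ] basis U y) w))
        ≈⟨ ∑-cong (U ⊠ U) (λ { (x , y) → *-congˡ (sym (K-mult x y w)) }) ⟩
      ∑ U (λ x → ∑ U (λ y → (u x * v y) * (K x ·[ V ] K y) w))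
        ≈⟨ linear-·-bilinear u v w ⟨
      (linear U V K u ·[ V ] linear U V K v) w ∎

  id⊗ε : ∀ U V → Poly (U ⊠ V) → Poly U
  id⊗ε U V t x = t (x , 0ₑ V)

  ε⊗id : ∀ U V → Poly (U ⊠ V) → Poly V
  ε⊗id U V t y = t (0ₑ U , y)

  id⊗ε-isMultiplicative : ∀ U V → IsMultiplicative (U ⊠ V) U (id⊗ε U V)
  id⊗ε-isMultiplicative U V = mkIsMultiplicative (U ⊠ V) U (λ s≋t x → s≋t (x , 0ₑ V)) id⊗ε-·
    (λ x → trans (*-congˡ (δ=-refl V (0ₑ V))) (*-identityʳ _))
    where
    id⊗ε-· : ∀ s t → id⊗ε U V (s ·[ U ⊠ V ] t) ≋ id⊗ε U V s ·[ U ] id⊗ε U V t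
    id⊗ε-· s t z = begin
      (s ·[ U ⊠ V ] t) (z , 0ₑ V)
        ≈⟨ ·-sliceʳ U V s t z (0ₑ V) ⟩
      ∑ V (λ x′ → ∑ V (λ y′ → δ+ V x′ y′ (0ₑ V) * ((λ x → s (x , x′)) ·[ U ] (λ y → t (y , y′))) z))
        ≈⟨ ∑-cong V (λ x′ → trans (∑-cong V (λ y′ → trans (*-congʳ (δ+-zero V x′ y′)) (*-assoc _ _ _)))
             (sym (*-distribˡ-∑ V _ _))) ⟩
      ∑ V (λ x′ → δ= V x′ (0ₑ V) * ∑ V (λ y′ → δ= V y′ (0ₑ V) * ((λ x → s (x , x′)) ·[ U ] (λ y → t (y , y′))) z))
        ≈⟨ ∑-δ= V (0ₑ V) _ ⟩
      ∑ V (λ y′ → δ= V y′ (0ₑ V) * ((λ x → s (x , 0ₑ V)) ·[ U ] (λ y → t (y , y′))) z)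
        ≈⟨ ∑-δ= V (0ₑ V) _ ⟩
      (id⊗ε U V s ·[ U ] id⊗ε U V t) z ∎

  ε⊗id-isMultiplicative : ∀ U V → IsMultiplicative (U ⊠ V) V (ε⊗id U V)
  ε⊗id-isMultiplicative U V = mkIsMultiplicative (U ⊠ V) V (λ s≋t y → s≋t (0ₑ U , y)) ε⊗id-·
    (λ y → trans (*-congʳ (δ=-refl U (0ₑ U))) (*-identityˡ _))
    where
    ε⊗id-· : ∀ s t → ε⊗id U V (s ·[ U ⊠ V ] t) ≋ ε⊗id U V s ·[ V ] ε⊗id U V t
    ε⊗id-· s t z′ = begin
      (s ·[ U ⊠ V ] t) (0ₑ U , z′)
        ≈⟨ ·-sliceˡ U V s t (0ₑ U) z′ ⟩
      ∑ U (λ x → ∑ U (λ y → δ+ U x y (0ₑ U) * ((λ x′ → s (x , x′)) ·[ V ] (λ y′ → t (y , y′))) z′))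
        ≈⟨ ∑-cong U (λ x → trans (∑-cong U (λ y → trans (*-congʳ (δ+-zero U x y)) (*-assoc _ _ _)))
             (sym (*-distribˡ-∑ U _ _))) ⟩
      ∑ U (λ x → δ= U x (0ₑ U) * ∑ U (λ y → δ= U y (0ₑ U) * ((λ x′ → s (x , x′)) ·[ V ] (λ y′ → t (y , y′))) z′))
        ≈⟨ ∑-δ= U (0ₑ U) _ ⟩
      ∑ U (λ y → δ= U y (0ₑ U) * ((λ x′ → s (0ₑ U , x′)) ·[ V ] (λ y′ → t (y , y′))) z′)
        ≈⟨ ∑-δ= U (0ₑ U) _ ⟩
      (ε⊗id U V s ·[ V ] ε⊗id U V t) z′ ∎

  linear-isMultiplicative : ∀ U V K → K (0ₑ U) ≋ 1ᴾ V → IsMultiplicativeOnBasis U V K →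
                            IsMultiplicative U V (linear U V K)
  linear-isMultiplicative U V K K0≋1 K-mult =
    mkIsMultiplicative U V (linear-cong U V K) (linear-· U V K K-mult) (linear-1ᴾ U V K K0≋1)

  linear-basis-id : ∀ U v → linear U U (basis U) v ≋ v
  linear-basis-id U v w = ∑-δ=ʳ U w v

  basis-isMultiplicativeOnBasis : ∀ U → IsMultiplicativeOnBasis U U (basis U)
  basis-isMultiplicativeOnBasis U x y w = sym (linear-basis-id U _ w)

  infixr 7 _⊗ᴷ_
  _⊗ᴷ_ : ∀ {U U′ V V′} → (Exponent U → Poly U′) → (Exponent V → Poly V′) → Exponent (U ⊠ V) → Poly (U′ ⊠ V′)
  (K ⊗ᴷ L) (x , y) = K x ⊗ L y

  linear-⊗ : ∀ U U′ V V′ K L a b →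
             linear (U ⊠ V) (U′ ⊠ V′) (K ⊗ᴷ L) (a ⊗ b) ≋ linear U U′ K a ⊗ linear V V′ L b
  linear-⊗ U U′ V V′ K L a b (w , w′) = trans (∑-cong (U ⊠ V) (λ _ → interchange _ _ _ _)) (∑-*-∑ U V _ _)

  ⊗ᴷ-isMultiplicativeOnBasis : ∀ U U′ V V′ K L → IsMultiplicativeOnBasis U U′ K → IsMultiplicativeOnBasis V V′ L →
                               IsMultiplicativeOnBasis (U ⊠ V) (U′ ⊠ V′) (K ⊗ᴷ L)
  ⊗ᴷ-isMultiplicativeOnBasis U U′ V V′ K L K-mult L-mult (x , y) (x′ , y′) w = begin
    ((K x ⊗ L y) ·[ U′ ⊠ V′ ] (K x′ ⊗ L y′)) w
      ≈⟨ ⊗-· U′ V′ (K x) (K x′) (L y) (L y′) w ⟩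
    ((K x ·[ U′ ] K x′) ⊗ (L y ·[ V′ ] L y′)) w
      ≈⟨ ⊗-cong (K-mult x x′) (L-mult y y′) w ⟩
    (linear U U′ K (basis U x ·[ U ] basis U x′) ⊗ linear V V′ L (basis V y ·[ V ] basis V y′)) w
      ≈⟨ linear-⊗ U U′ V V′ K L _ _ w ⟨
    linear (U ⊠ V) (U′ ⊠ V′) (K ⊗ᴷ L) ((basis U x ·[ U ] basis U x′) ⊗ (basis V y ·[ V ] basis V y′)) w
      ≈⟨ linear-cong (U ⊠ V) (U′ ⊠ V′) (K ⊗ᴷ L) (⊗-· U V _ _ _ _) w ⟨
    linear (U ⊠ V) (U′ ⊠ V′) (K ⊗ᴷ L) (basis (U ⊠ V) (x , y) ·[ U ⊠ V ] basis (U ⊠ V) (x′ , y′)) w ∎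

  assocʳ : ∀ U V W → Poly (U ⊠ V ⊠ W) → Poly ((U ⊠ V) ⊠ W)
  assocʳ U V W t ((x , y) , z) = t (x , y , z)

  assocʳ-isMultiplicative : ∀ U V W → IsMultiplicative (U ⊠ V ⊠ W) ((U ⊠ V) ⊠ W) (assocʳ U V W)
  assocʳ-isMultiplicative U V W = mkIsMultiplicative (U ⊠ V ⊠ W) ((U ⊠ V) ⊠ W)
    (λ s≋t → λ { ((x , y) , z) → s≋t (x , y , z) })
    (λ s t → λ { ((x , y) , z) → ∑-cong ((U ⊠ V ⊠ W) ⊠ (U ⊠ V ⊠ W)) (λ _ → *-congʳ (sym (*-assoc _ _ _))) })
    (λ { ((x , y) , z) → sym (*-assoc _ _ _) })

  pair-assocʳ : ∀ U V W f g h t →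
                ⟨ (f ⊗ g) ⊗ h ∣ assocʳ U V W t ⟩[ (U ⊠ V) ⊠ W ] ≈ ⟨ f ⊗ (g ⊗ h) ∣ t ⟩[ U ⊠ V ⊠ W ]
  pair-assocʳ U V W f g h t = ∑-cong (U ⊠ V ⊠ W) (λ _ → *-congˡ (*-assoc _ _ _))

  omit : ∀ U → Exponent U → (Exponent U → Carrier) → Exponent U → Carrier
  omit U m F n with ≟ₑ U n m
  ... | yes _ = 0#
  ... | no  _ = F n

  ∑-omit : ∀ U m F → ∑ U F ≈ F m + ∑ U (omit U m F)
  ∑-omit U m F = begin
    ∑ U F                                              ≈⟨ ∑-cong U split ⟩
    ∑ U (λ n → δ= U n m * F m + omit U m F n)          ≈⟨ ∑-distrib-+ U _ _ ⟩
    ∑ U (λ n → δ= U n m * F m) + ∑ U (omit U m F)      ≈⟨ +-congʳ (∑-δ= U m (λ _ → F m)) ⟩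
    F m + ∑ U (omit U m F)                             ∎
    where
    split : ∀ n → F n ≈ δ= U n m * F m + omit U m F n
    split n with ≟ₑ U n m
    ... | yes ≡.refl = sym (trans (+-identityʳ _) (trans (*-congʳ (δ=-refl U n)) (*-identityˡ _)))
    ... | no  n≢m    = sym (trans (+-congʳ (trans (*-congʳ (δ=-≢ U n≢m)) (zeroˡ _))) (+-identityˡ _))

  module TriangularSystem U (C : Exponent U → Exponent U → Carrier) (deg : Exponent U → ℕ)
    (lower : ∀ m n → n ≢ m → deg m ≤ deg n → C m n ≈ 0#)
    (inv : Exponent U → Carrier) (inv-ok : ∀ m → C m m * inv m ≈ 1#) (e : Exponent U → Carrier) where

    residual : Poly U → Exponent U → Carrier
    residual g m = ∑ U (omit U m (λ n → C m n * g n))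

    approx : ℕ → Poly U
    approx zero    m = 0#
    approx (suc k) m = inv m * (e m - residual (approx k) m)

    -- Row m only involves entries of smaller degree, so approx k is final on rows of degree < k.
    approx-stable : ∀ k m → deg m < k → approx (suc k) m ≈ approx k m
    approx-stable (suc k) m deg<1+k = *-congˡ (+-congˡ (-‿cong (∑-cong U same-terms)))
      where
      same-terms : ∀ n → omit U m (λ n → C m n * approx (suc k) n) n ≈ omit U m (λ n → C m n * approx k n) n
      same-terms n with ≟ₑ U n m
      ... | yes _ = refl
      ... | no n≢m with deg n ℕ.<? deg m
      ...   | yes deg-n<m = *-congˡ (approx-stable k n (ℕ.<-≤-trans deg-n<m (ℕ.≤-pred deg<1+k)))
      ...   | no  deg-n≮m = trans (C≈0 _) (sym (C≈0 _))
        where C≈0 = λ g → trans (*-congʳ (lower m n n≢m (ℕ.≮⇒≥ deg-n≮m))) (zeroˡ g)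

    solution : ∀ N → (∀ m → deg m < N) → ∃ λ g → ∀ m → ∑ U (λ n → C m n * g n) ≈ e m
    solution N deg<N = approx N , solves
      where
      solves : ∀ m → ∑ U (λ n → C m n * approx N n) ≈ e m
      solves m = begin
        ∑ U (λ n → C m n * approx N n)                 ≈⟨ ∑-omit U m _ ⟩
        C m m * approx N m + r                         ≈⟨ +-congʳ (*-congˡ (sym (approx-stable N m (deg<N m)))) ⟩
        C m m * (inv m * (e m - r)) + r
          ≈⟨ +-congʳ (trans (sym (*-assoc _ _ _)) (trans (*-congʳ (inv-ok m)) (*-identityˡ _))) ⟩
        (e m - r) + r                                  ≈⟨ +-assoc _ _ _ ⟩
        e m + (- r + r)                                ≈⟨ +-congˡ (-‿inverseˡ r) ⟩
        e m + 0#                                       ≈⟨ +-identityʳ _ ⟩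
        e m                                            ∎
        where r = residual (approx N) m

module Gλ {c ℓ} (B : CommutativeRing c ℓ) (p : ℕ) (p-prime : Prime p)
          (char-p : CommutativeRing._≈_ B (RingOps.fromℕ B p) (CommutativeRing.0# B))
          (lam : CommutativeRing.Carrier B) where

  private instance
    p-nonTrivial : NonTrivial p
    p-nonTrivial = prime⇒nonTrivial p-prime
    p-nonZero : NonZero p
    p-nonZero = ℕ.nonTrivial⇒nonZero p

  open CommutativeRing B hiding (zero)
  open RingOps B using (δ; fromℕ; pow; sumFin; sumℕ; IsUnit)
  open GroupAlgebra B p lam using (Mono; sumMono; e₁; e₂; Tensor; _⊗·_; oneT; powT; ΔX; ΔY; Δ; ε; conv; IsConvUnit; T; D)
  open Kronecker B
  open TruncatedPolynomials B p ⦃ p-nonZero ⦄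
  open Units B
  open import Algebra.Properties.Semiring.Sum semiring using (sum)
  open import Relation.Binary.Reasoning.Setoid setoid
  open import Algebra.Solver.Ring.NaturalCoefficients.Default commutativeSemiring

  A A² A³ : Shape
  A  = var ⊠ var
  A² = A ⊠ A
  A³ = A² ⊠ A

  X^_Y^_ : ℕ → ℕ → Poly A
  X^ a Y^ b = var^ a ⊗ var^ b

  X Y u : Poly A
  X = X^ 1 Y^ 0
  Y = X^ 0 Y^ 1
  u = 1ᴾ A +ᴾ lam • X

  X^0Y^0 : X^ 0 Y^ 0 ≋ 1ᴾ A
  X^0Y^0 = ⊗-cong var^-0 var^-0

  X^Y^-· : ∀ a b a′ b′ → X^ a Y^ b ·[ A ] X^ a′ Y^ b′ ≋ X^ (a ℕ.+ a′) Y^ (b ℕ.+ b′)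
  X^Y^-· a b a′ b′ x = trans (⊗-· var var _ _ _ _ x) (⊗-cong (var^-· a a′) (var^-· b b′) x)

  X^Y^-^ : ∀ a b n → X^ a Y^ b ^[ A ] n ≋ X^ (n ℕ.* a) Y^ (n ℕ.* b)
  X^Y^-^ a b zero    x = sym (X^0Y^0 x)
  X^Y^-^ a b (suc n) x = trans (·-cong A {X^ a Y^ b} (λ _ → refl) (X^Y^-^ a b n) x) (X^Y^-· a b _ _ x)

  X^Y^-≥p : ∀ a b → p ≤ a ⊎ p ≤ b → X^ a Y^ b ≋ 0ᴾ
  X^Y^-≥p a b (inj₁ p≤a) = ⊗-zeroˡ (var^ b) (var^-≥p a p≤a)
  X^Y^-≥p a b (inj₂ p≤b) = ⊗-zeroʳ (var^ a) (var^-≥p b p≤b)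

  ∑-X^Y^ : ∀ a b → a < p → b < p → ∑ A (X^ a Y^ b) ≈ 1#
  ∑-X^Y^ a b a<p b<p = trans (∑-*-∑ var var _ _) (trans (*-cong (∑-var^ a a<p) (∑-var^ b b<p)) (*-identityˡ 1#))

  X^p : X ^[ A ] p ≋ 0ᴾ
  X^p x = trans (X^Y^-^ 1 0 p x) (X^Y^-≥p _ _ (inj₁ (ℕ.≤-reflexive (≡.sym (ℕ.*-identityʳ p)))) x)

  Y^p : Y ^[ A ] p ≋ 0ᴾ
  Y^p x = trans (X^Y^-^ 0 1 p x) (X^Y^-≥p _ _ (inj₂ (ℕ.≤-reflexive (≡.sym (ℕ.*-identityʳ p)))) x)

  X^Y^≋X^·Y^ : ∀ a b → X^ a Y^ b ≋ X ^[ A ] a ·[ A ] Y ^[ A ] b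
  X^Y^≋X^·Y^ a b x = sym (trans (·-cong A (X^Y^-^ 1 0 a) (X^Y^-^ 0 1 b) x) (trans (X^Y^-· _ _ _ _ x)
    (reflexive (≡.cong₂ (λ i j → (X^ i Y^ j) x)
      (≡.trans (≡.cong₂ ℕ._+_ (ℕ.*-identityʳ a) (ℕ.*-zeroʳ b)) (ℕ.+-identityʳ a))
      (≡.cong₂ ℕ._+_ (ℕ.*-zeroʳ a) (ℕ.*-identityʳ b))))))

  X-at-0ₑ : X (0ₑ A) ≈ 0#
  X-at-0ₑ rewrite toℕ-0ₑ = zeroˡ _

  Y-at-0ₑ : Y (0ₑ A) ≈ 0#
  Y-at-0ₑ rewrite toℕ-0ₑ = zeroʳ _

  u-at-0ₑ : u (0ₑ A) ≈ 1#
  u-at-0ₑ = trans (+-cong (δ=-refl A (0ₑ A)) (trans (*-congˡ X-at-0ₑ) (zeroʳ _))) (+-identityʳ _)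

  1ₑ : Fin p
  1ₑ = fromℕ< (ℕ.nonTrivial⇒n>1 p)

  toℕ-1ₑ : toℕ 1ₑ ≡ 1
  toℕ-1ₑ = Fin.toℕ-fromℕ< _

  X≋basis : X ≋ basis A (1ₑ , 0ₑ var)
  X≋basis (x , y) = reflexive (≡.cong₂ (λ i j → δ (toℕ x) i * δ (toℕ y) j) (≡.sym toℕ-1ₑ) (≡.sym toℕ-0ₑ))

  Y≋basis : Y ≋ basis A (0ₑ var , 1ₑ)
  Y≋basis (x , y) = reflexive (≡.cong₂ (λ i j → δ (toℕ x) i * δ (toℕ y) j) (≡.sym toℕ-0ₑ) (≡.sym toℕ-1ₑ))

  u^p : u ^[ A ] p ≋ 1ᴾ A
  u^p x = begin
    (u ^[ A ] p) x                                        ≈⟨ frobenius p-prime char-p A (1ᴾ A) (lam • X) x ⟩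
    (1ᴾ A ^[ A ] p) x + ((lam • X) ^[ A ] p) x            ≈⟨ +-cong (1ᴾ-^ A p x) (•-^ A lam X p x) ⟩
    1ᴾ A x + pow lam p * (X ^[ A ] p) x                   ≈⟨ +-congˡ (trans (*-congˡ (X^p x)) (zeroʳ _)) ⟩
    1ᴾ A x + 0#                                           ≈⟨ +-identityʳ _ ⟩
    1ᴾ A x                                                ∎

  u^-periodic : ∀ r → u ^[ A ] (p ℕ.+ r) ≋ u ^[ A ] r
  u^-periodic r x = trans (^-homo-· A u p r x) (trans (·-cong A u^p (λ _ → refl) x) (·-identityˡ A _ x))

  sumFin≡sum : ∀ n (g : Fin n → Carrier) → sumFin n g ≡ sum g
  sumFin≡sum zero    g = ≡.refl
  sumFin≡sum (suc n) g = ≡.cong (g Fin.zero +_) (sumFin≡sum n (λ i → g (Fin.suc i)))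

  sumMono≈∑ : ∀ {g h : Mono → Carrier} → (∀ m → g m ≈ h m) → sumMono g ≈ ∑ A h
  sumMono≈∑ {g} g≈h = trans (reflexive (sumFin≡sum p _))
    (∑-cong var (λ i → trans (reflexive (sumFin≡sum p _)) (∑-cong var (λ j → g≈h (i , j)))))

  fromTensor : Tensor → Poly A²
  fromTensor t (m , n) = t m n

  fromTensor-⊗· : ∀ s t → fromTensor (s ⊗· t) ≋ fromTensor s ·[ A² ] fromTensor t
  fromTensor-⊗· s t (m , n) = begin
    sumMono (λ m₁ → sumMono (λ m₂ → sumMono (λ n₁ → sumMono (λ n₂ → δ+ A² (m₁ , n₁) (m₂ , n₂) (m , n) * (s m₁ n₁ * t m₂ n₂)))))
      ≈⟨ sumMono≈∑ (λ m₁ → sumMono≈∑ (λ m₂ → sumMono≈∑ (λ n₁ → sumMono≈∑ (λ n₂ → refl)))) ⟩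
    ∑ A (λ m₁ → ∑ A (λ m₂ → ∑ A (λ n₁ → ∑ A (λ n₂ → δ+ A² (m₁ , n₁) (m₂ , n₂) (m , n) * (s m₁ n₁ * t m₂ n₂)))))
      ≈⟨ ∑-cong A (λ m₁ → ∑-comm A A _) ⟩
    (fromTensor s ·[ A² ] fromTensor t) (m , n) ∎

  fromTensor-oneT : fromTensor oneT ≋ 1ᴾ A²
  fromTensor-oneT (m , n) = *-cong (X^0Y^0 m) (X^0Y^0 n)

  fromTensor-powT : ∀ t n → fromTensor (powT t n) ≋ fromTensor t ^[ A² ] n
  fromTensor-powT t zero    = fromTensor-oneT
  fromTensor-powT t (suc n) x =
    trans (fromTensor-⊗· t (powT t n) x) (·-cong A² {fromTensor t} (λ _ → refl) (fromTensor-powT t n) x)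

  Δᴾ : Exponent A → Poly A²
  Δᴾ m = fromTensor (Δ m)

  ΔXᴾ ΔYᴾ : Poly A²
  ΔXᴾ = fromTensor ΔX
  ΔYᴾ = fromTensor ΔY

  ΔX^_ΔY^_ : ℕ → ℕ → Poly A²
  ΔX^ a ΔY^ b = ΔXᴾ ^[ A² ] a ·[ A² ] ΔYᴾ ^[ A² ] b

  Δᴾ-form : ∀ m → Δᴾ m ≋ ΔX^ e₁ m ΔY^ e₂ m
  Δᴾ-form m x = trans (fromTensor-⊗· _ _ x) (·-cong A² (fromTensor-powT ΔX (e₁ m)) (fromTensor-powT ΔY (e₂ m)) x)

  skew : Poly A → Poly A²
  skew G = G ⊗ 1ᴾ A +ᴾ u ⊗ G

  ΔX-skew : ΔXᴾ ≋ skew X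
  ΔX-skew (m , n) = begin
    (X m * (X^ 0 Y^ 0) n + (X^ 0 Y^ 0) m * X n) + lam * (X m * X n)
      ≈⟨ +-cong (+-cong (*-congˡ (X^0Y^0 n)) (*-congʳ (X^0Y^0 m))) refl ⟩
    (X m * 1ᴾ A n + 1ᴾ A m * X n) + lam * (X m * X n)
      ≈⟨ solve 5 (λ x₁ o₂ o₁ x₂ l → (x₁ :* o₂ :+ o₁ :* x₂) :+ l :* (x₁ :* x₂) := x₁ :* o₂ :+ (o₁ :+ l :* x₁) :* x₂)
           refl (X m) (1ᴾ A n) (1ᴾ A m) (X n) lam ⟩
    skew X (m , n) ∎

  ΔY-skew : ΔYᴾ ≋ skew Y
  ΔY-skew (m , n) = begin
    (Y m * (X^ 0 Y^ 0) n + (X^ 0 Y^ 0) m * Y n) + lam * (X m * Y n)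
      ≈⟨ +-cong (+-cong (*-congˡ (X^0Y^0 n)) (*-congʳ (X^0Y^0 m))) refl ⟩
    (Y m * 1ᴾ A n + 1ᴾ A m * Y n) + lam * (X m * Y n)
      ≈⟨ solve 6 (λ y₁ o₂ o₁ y₂ l x₁ → (y₁ :* o₂ :+ o₁ :* y₂) :+ l :* (x₁ :* y₂) := y₁ :* o₂ :+ (o₁ :+ l :* x₁) :* y₂)
           refl (Y m) (1ᴾ A n) (1ᴾ A m) (Y n) lam (X m) ⟩
    skew Y (m , n) ∎

  skew-^p : ∀ G → G ^[ A ] p ≋ 0ᴾ → skew G ^[ A² ] p ≋ 0ᴾ
  skew-^p G G^p≋0 x = begin
    (skew G ^[ A² ] p) x                                            ≈⟨ frobenius p-prime char-p A² (G ⊗ 1ᴾ A) (u ⊗ G) x ⟩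
    ((G ⊗ 1ᴾ A) ^[ A² ] p) x + ((u ⊗ G) ^[ A² ] p) x                ≈⟨ +-cong (⊗-^ A A G (1ᴾ A) p x) (⊗-^ A A u G p x) ⟩
    ((G ^[ A ] p) ⊗ (1ᴾ A ^[ A ] p)) x + ((u ^[ A ] p) ⊗ (G ^[ A ] p)) x
      ≈⟨ +-cong (⊗-zeroˡ (1ᴾ A ^[ A ] p) G^p≋0 x) (⊗-zeroʳ (u ^[ A ] p) G^p≋0 x) ⟩
    0# + 0#                                                         ≈⟨ +-identityˡ 0# ⟩
    0#                                                              ∎

  ^-≥p : ∀ t → t ^[ A² ] p ≋ 0ᴾ → ∀ n → p ≤ n → t ^[ A² ] n ≋ 0ᴾ
  ^-≥p t t^p≋0 n p≤n x = begin
    (t ^[ A² ] n) x                                  ≡⟨ ≡.cong (λ k → (t ^[ A² ] k) x) (≡.sym (ℕ.m+[n∸m]≡n p≤n)) ⟩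
    (t ^[ A² ] (p ℕ.+ (n ℕ.∸ p))) x                  ≈⟨ ^-homo-· A² t p (n ℕ.∸ p) x ⟩
    (t ^[ A² ] p ·[ A² ] t ^[ A² ] (n ℕ.∸ p)) x      ≈⟨ ·-cong A² t^p≋0 (λ _ → refl) x ⟩
    (0ᴾ ·[ A² ] t ^[ A² ] (n ℕ.∸ p)) x               ≈⟨ ·-zeroˡ A² _ x ⟩
    0#                                               ∎

  ΔX^ΔY^-≥p : ∀ a b → p ≤ a ⊎ p ≤ b → ΔX^ a ΔY^ b ≋ 0ᴾ
  ΔX^ΔY^-≥p a b (inj₁ p≤a) x = trans (·-cong A² (^-≥p ΔXᴾ ΔX^p a p≤a) (λ _ → refl) x) (·-zeroˡ A² _ x)
    where ΔX^p = λ x → trans (^-cong A² p ΔX-skew x) (skew-^p X X^p x)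
  ΔX^ΔY^-≥p a b (inj₂ p≤b) x = trans (·-comm A² _ _ x) (trans (·-cong A² (^-≥p ΔYᴾ ΔY^p b p≤b) (λ _ → refl) x) (·-zeroˡ A² _ x))
    where ΔY^p = λ x → trans (^-cong A² p ΔY-skew x) (skew-^p Y Y^p x)

  ΔX^ΔY^-· : ∀ a b a′ b′ → ΔX^ a ΔY^ b ·[ A² ] ΔX^ a′ ΔY^ b′ ≋ ΔX^ (a ℕ.+ a′) ΔY^ (b ℕ.+ b′)
  ΔX^ΔY^-· a b a′ b′ x = begin
    (ΔX^ a ΔY^ b ·[ A² ] (ΔX^ a′ ΔY^ b′)) x
      ≈⟨ CSP.interchange (ΔXᴾ ^[ A² ] a) (ΔYᴾ ^[ A² ] b) (ΔXᴾ ^[ A² ] a′) (ΔYᴾ ^[ A² ] b′) x ⟩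
    ((ΔXᴾ ^[ A² ] a ·[ A² ] ΔXᴾ ^[ A² ] a′) ·[ A² ] (ΔYᴾ ^[ A² ] b ·[ A² ] ΔYᴾ ^[ A² ] b′)) x
      ≈⟨ ·-cong A² (^-homo-· A² ΔXᴾ a a′) (^-homo-· A² ΔYᴾ b b′) x ⟨
    (ΔX^ (a ℕ.+ a′) ΔY^ (b ℕ.+ b′)) x ∎
    where module CSP = Algebra.Properties.CommutativeSemigroup
                         (CommutativeSemiring.*-commutativeSemigroup (Poly-commutativeSemiring A²))

  Δᴾ-0ₑ : Δᴾ (0ₑ A) ≋ 1ᴾ A²
  Δᴾ-0ₑ x = trans (Δᴾ-form (0ₑ A) x)
    (trans (reflexive (≡.cong₂ (λ i j → (ΔX^ i ΔY^ j) x) toℕ-0ₑ toℕ-0ₑ)) (·-identityˡ A² (1ᴾ A²) x))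

  Δᴾ-isMultiplicativeOnBasis : IsMultiplicativeOnBasis A A² Δᴾ
  Δᴾ-isMultiplicativeOnBasis (x₁ , x₂) (y₁ , y₂) w = begin
    (Δᴾ (x₁ , x₂) ·[ A² ] Δᴾ (y₁ , y₂)) w
      ≈⟨ ·-cong A² (Δᴾ-form (x₁ , x₂)) (Δᴾ-form (y₁ , y₂)) w ⟩
    (ΔX^ toℕ x₁ ΔY^ toℕ x₂ ·[ A² ] (ΔX^ toℕ y₁ ΔY^ toℕ y₂)) w
      ≈⟨ ΔX^ΔY^-· (toℕ x₁) (toℕ x₂) (toℕ y₁) (toℕ y₂) w ⟩
    (ΔX^ s₁ ΔY^ s₂) w
      ≈⟨ sum-δ p s₂ (λ k → (ΔX^ s₁ ΔY^ k) w) (λ p≤s₂ → ΔX^ΔY^-≥p s₁ s₂ (inj₂ p≤s₂) w) ⟨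
    ∑ var (λ z₂ → δ s₂ (toℕ z₂) * (ΔX^ s₁ ΔY^ toℕ z₂) w)
      ≈⟨ sum-δ p s₁ (λ k → ∑ var (λ z₂ → δ s₂ (toℕ z₂) * (ΔX^ k ΔY^ toℕ z₂) w))
           (λ p≤s₁ → ∑-zero var (λ z₂ → trans (*-congˡ (ΔX^ΔY^-≥p s₁ (toℕ z₂) (inj₁ p≤s₁) w)) (zeroʳ _))) ⟨
    ∑ var (λ z₁ → δ s₁ (toℕ z₁) * ∑ var (λ z₂ → δ s₂ (toℕ z₂) * (ΔX^ toℕ z₁ ΔY^ toℕ z₂) w))
      ≈⟨ ∑-cong var (λ z₁ → trans (*-distribˡ-∑ var _ _) (∑-cong var (λ z₂ →
           trans (sym (*-assoc _ _ _)) (*-congˡ (sym (Δᴾ-form (z₁ , z₂) w)))))) ⟩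
    ∑ A (λ z → δ+ A (x₁ , x₂) (y₁ , y₂) z * Δᴾ z w)
      ≈⟨ ∑-cong A (λ z → *-congʳ (basis-· A (x₁ , x₂) (y₁ , y₂) z)) ⟨
    linear A A² Δᴾ (basis A (x₁ , x₂) ·[ A ] basis A (y₁ , y₂)) w ∎
    where
    s₁ = toℕ x₁ ℕ.+ toℕ y₁
    s₂ = toℕ x₂ ℕ.+ toℕ y₂

  LΔ : Poly A → Poly A²
  LΔ = linear A A² Δᴾ

  LΔ-isMultiplicative : IsMultiplicative A A² LΔ
  LΔ-isMultiplicative = linear-isMultiplicative A A² Δᴾ Δᴾ-0ₑ Δᴾ-isMultiplicativeOnBasis

  Δᴾ-image : ∀ W φ → IsMultiplicative A² W φ → ∀ m → φ (Δᴾ m) ≋ φ ΔXᴾ ^[ W ] e₁ m ·[ W ] φ ΔYᴾ ^[ W ] e₂ m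
  Δᴾ-image W φ φ-mult m x =
    trans (⟦⟧-cong (Δᴾ-form m) x)
      (trans (homo _ _ x) (·-cong W (^-homo A² W φ-mult ΔXᴾ (e₁ m)) (^-homo A² W φ-mult ΔYᴾ (e₂ m)) x))
    where open PolyMonoidMorphisms.IsMonoidHomomorphism A² W φ-mult

  Δᴾ-counit : ∀ φ → IsMultiplicative A² A φ → (∀ G → G (0ₑ A) ≈ 0# → φ (skew G) ≋ G) →
              ∀ m → φ (Δᴾ m) ≋ basis A m
  Δᴾ-counit φ φ-mult φ-skew m x = begin
    φ (Δᴾ m) x                                            ≈⟨ Δᴾ-image A φ φ-mult m x ⟩
    (φ ΔXᴾ ^[ A ] e₁ m ·[ A ] φ ΔYᴾ ^[ A ] e₂ m) x        ≈⟨ ·-cong A (^-cong A (e₁ m) φ-ΔX) (^-cong A (e₂ m) φ-ΔY) x ⟩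
    (X ^[ A ] e₁ m ·[ A ] Y ^[ A ] e₂ m) x                ≈⟨ X^Y^≋X^·Y^ (e₁ m) (e₂ m) x ⟨
    basis A m x                                           ∎
    where
    open PolyMonoidMorphisms.IsMonoidHomomorphism A² A φ-mult using (⟦⟧-cong)
    φ-ΔX = λ x → trans (⟦⟧-cong ΔX-skew x) (φ-skew X X-at-0ₑ x)
    φ-ΔY = λ x → trans (⟦⟧-cong ΔY-skew x) (φ-skew Y Y-at-0ₑ x)

  Δᴾ-counitʳ : ∀ m → id⊗ε A A (Δᴾ m) ≋ basis A m
  Δᴾ-counitʳ = Δᴾ-counit (id⊗ε A A) (id⊗ε-isMultiplicative A A) λ G G0≈0 x →
    trans (+-cong (trans (*-congˡ (δ=-refl A (0ₑ A))) (*-identityʳ _)) (trans (*-congˡ G0≈0) (zeroʳ _))) (+-identityʳ _)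

  Δᴾ-counitˡ : ∀ m → ε⊗id A A (Δᴾ m) ≋ basis A m
  Δᴾ-counitˡ = Δᴾ-counit (ε⊗id A A) (ε⊗id-isMultiplicative A A) λ G G0≈0 x →
    trans (+-cong (trans (*-congʳ G0≈0) (zeroˡ _)) (trans (*-congʳ u-at-0ₑ) (*-identityˡ _))) (+-identityˡ _)

  LΔ-X : LΔ X ≋ skew X
  LΔ-X x = begin
    LΔ X x                                        ≈⟨ linear-cong A A² Δᴾ X≋basis x ⟩
    LΔ (basis A (1ₑ , 0ₑ var)) x                  ≈⟨ linear-basis A A² Δᴾ (1ₑ , 0ₑ var) x ⟩
    Δᴾ (1ₑ , 0ₑ var) x                            ≈⟨ Δᴾ-form (1ₑ , 0ₑ var) x ⟩
    (ΔX^ toℕ 1ₑ ΔY^ toℕ (0ₑ var)) x               ≡⟨ ≡.cong₂ (λ i j → (ΔX^ i ΔY^ j) x) toℕ-1ₑ toℕ-0ₑ ⟩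
    ((ΔXᴾ ·[ A² ] 1ᴾ A²) ·[ A² ] 1ᴾ A²) x         ≈⟨ trans (·-comm A² _ _ x) (·-identityˡ A² _ x) ⟩
    (ΔXᴾ ·[ A² ] 1ᴾ A²) x                         ≈⟨ trans (·-comm A² _ _ x) (·-identityˡ A² _ x) ⟩
    ΔXᴾ x                                         ≈⟨ ΔX-skew x ⟩
    skew X x                                      ∎

  LΔ-Y : LΔ Y ≋ skew Y
  LΔ-Y x = begin
    LΔ Y x                                        ≈⟨ linear-cong A A² Δᴾ Y≋basis x ⟩
    LΔ (basis A (0ₑ var , 1ₑ)) x                  ≈⟨ linear-basis A A² Δᴾ (0ₑ var , 1ₑ) x ⟩
    Δᴾ (0ₑ var , 1ₑ) x                            ≈⟨ Δᴾ-form (0ₑ var , 1ₑ) x ⟩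
    (ΔX^ toℕ (0ₑ var) ΔY^ toℕ 1ₑ) x               ≡⟨ ≡.cong₂ (λ i j → (ΔX^ i ΔY^ j) x) toℕ-0ₑ toℕ-1ₑ ⟩
    (1ᴾ A² ·[ A² ] (ΔYᴾ ·[ A² ] 1ᴾ A²)) x         ≈⟨ ·-identityˡ A² _ x ⟩
    (ΔYᴾ ·[ A² ] 1ᴾ A²) x                         ≈⟨ trans (·-comm A² _ _ x) (·-identityˡ A² _ x) ⟩
    ΔYᴾ x                                         ≈⟨ ΔY-skew x ⟩
    skew Y x                                      ∎

  LΔ-1ᴾ : LΔ (1ᴾ A) ≋ 1ᴾ A²
  LΔ-1ᴾ = linear-1ᴾ A A² Δᴾ Δᴾ-0ₑ

  LΔ-u : LΔ u ≋ u ⊗ u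
  LΔ-u (x , y) = begin
    LΔ u (x , y)                                          ≈⟨ linear-+ᴾ A A² Δᴾ (1ᴾ A) (lam • X) (x , y) ⟩
    LΔ (1ᴾ A) (x , y) + LΔ (lam • X) (x , y)
      ≈⟨ +-cong (LΔ-1ᴾ (x , y)) (trans (linear-• A A² Δᴾ lam X (x , y)) (*-congˡ (LΔ-X (x , y)))) ⟩
    1ᴾ A x * 1ᴾ A y + lam * (X x * 1ᴾ A y + u x * X y)    ≈⟨ solve 5 (λ o₁ o₂ x₁ x₂ l →
                                                               o₁ :* o₂ :+ l :* (x₁ :* o₂ :+ (o₁ :+ l :* x₁) :* x₂)
                                                               := (o₁ :+ l :* x₁) :* (o₂ :+ l :* x₂)) refl _ _ _ _ _ ⟩
    (u ⊗ u) (x , y)                                       ∎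

  LΔ-u^ : ∀ r → LΔ (u ^[ A ] r) ≋ u ^[ A ] r ⊗ u ^[ A ] r
  LΔ-u^ r x = trans (^-homo A A² LΔ-isMultiplicative u r x) (trans (^-cong A² r LΔ-u x) (⊗-^ A A u u r x))

  Δ⊗id : Poly A² → Poly A³
  Δ⊗id = linear A² A³ (Δᴾ ⊗ᴷ basis A)

  id⊗Δ : Poly A² → Poly A³
  id⊗Δ t = assocʳ A A A (linear A² (A ⊠ A²) (basis A ⊗ᴷ Δᴾ) t)

  Δ⊗id-isMultiplicative : IsMultiplicative A² A³ Δ⊗id
  Δ⊗id-isMultiplicative = linear-isMultiplicative A² A³ (Δᴾ ⊗ᴷ basis A) (⊗-cong Δᴾ-0ₑ (λ _ → refl))
    (⊗ᴷ-isMultiplicativeOnBasis A A² A A Δᴾ (basis A) Δᴾ-isMultiplicativeOnBasis (basis-isMultiplicativeOnBasis A))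

  id⊗Δ-isMultiplicative : IsMultiplicative A² A³ id⊗Δ
  id⊗Δ-isMultiplicative = isMonoidHomomorphism (λ s≋t t≋v x → trans (s≋t x) (t≋v x))
    (linear-isMultiplicative A² (A ⊠ A²) (basis A ⊗ᴷ Δᴾ) (⊗-cong (λ _ → refl) Δᴾ-0ₑ)
      (⊗ᴷ-isMultiplicativeOnBasis A A A A² (basis A) Δᴾ (basis-isMultiplicativeOnBasis A) Δᴾ-isMultiplicativeOnBasis))
    (assocʳ-isMultiplicative A A A)

  skew-coassoc : ∀ G → LΔ G ≋ skew G → Δ⊗id (skew G) ≋ id⊗Δ (skew G)
  skew-coassoc G LΔG ((x , y) , z) = begin
    Δ⊗id (skew G) ((x , y) , z)
      ≈⟨ linear-+ᴾ A² A³ (Δᴾ ⊗ᴷ basis A) (G ⊗ 1ᴾ A) (u ⊗ G) ((x , y) , z) ⟩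
    Δ⊗id (G ⊗ 1ᴾ A) ((x , y) , z) + Δ⊗id (u ⊗ G) ((x , y) , z)
      ≈⟨ +-cong (linear-⊗ A A² A A Δᴾ (basis A) G (1ᴾ A) ((x , y) , z)) (linear-⊗ A A² A A Δᴾ (basis A) u G ((x , y) , z)) ⟩
    LΔ G (x , y) * linear A A (basis A) (1ᴾ A) z + LΔ u (x , y) * linear A A (basis A) G z
      ≈⟨ +-cong (*-cong (LΔG (x , y)) (linear-basis-id A (1ᴾ A) z)) (*-cong (LΔ-u (x , y)) (linear-basis-id A G z)) ⟩
    (G x * 1ᴾ A y + u x * G y) * 1ᴾ A z + u x * u y * G z
      ≈⟨ solve 8 (λ gx gy gz ox oy oz ux uy → (gx :* oy :+ ux :* gy) :* oz :+ ux :* uy :* gz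
                  := gx :* (oy :* oz) :+ ux :* (gy :* oz :+ uy :* gz)) refl (G x) (G y) (G z) (1ᴾ A x) (1ᴾ A y) (1ᴾ A z) (u x) (u y) ⟩
    G x * (1ᴾ A y * 1ᴾ A z) + u x * (G y * 1ᴾ A z + u y * G z)
      ≈⟨ +-cong (*-cong (linear-basis-id A G x) (LΔ-1ᴾ (y , z))) (*-cong (linear-basis-id A u x) (LΔG (y , z))) ⟨
    linear A A (basis A) G x * LΔ (1ᴾ A) (y , z) + linear A A (basis A) u x * LΔ G (y , z)
      ≈⟨ +-cong (linear-⊗ A A A A² (basis A) Δᴾ G (1ᴾ A) (x , y , z)) (linear-⊗ A A A A² (basis A) Δᴾ u G (x , y , z)) ⟨
    id⊗Δ (G ⊗ 1ᴾ A) ((x , y) , z) + id⊗Δ (u ⊗ G) ((x , y) , z)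
      ≈⟨ linear-+ᴾ A² (A ⊠ A²) (basis A ⊗ᴷ Δᴾ) (G ⊗ 1ᴾ A) (u ⊗ G) (x , y , z) ⟨
    id⊗Δ (skew G) ((x , y) , z) ∎

  Δᴾ-coassoc : ∀ m → Δ⊗id (Δᴾ m) ≋ id⊗Δ (Δᴾ m)
  Δᴾ-coassoc m x = begin
    Δ⊗id (Δᴾ m) x
      ≈⟨ Δᴾ-image A³ Δ⊗id Δ⊗id-isMultiplicative m x ⟩
    (Δ⊗id ΔXᴾ ^[ A³ ] e₁ m ·[ A³ ] Δ⊗id ΔYᴾ ^[ A³ ] e₂ m) x
      ≈⟨ ·-cong A³ (^-cong A³ (e₁ m) (on-skew ΔX-skew LΔ-X)) (^-cong A³ (e₂ m) (on-skew ΔY-skew LΔ-Y)) x ⟩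
    (id⊗Δ ΔXᴾ ^[ A³ ] e₁ m ·[ A³ ] id⊗Δ ΔYᴾ ^[ A³ ] e₂ m) x
      ≈⟨ Δᴾ-image A³ id⊗Δ id⊗Δ-isMultiplicative m x ⟨
    id⊗Δ (Δᴾ m) x ∎
    where
    module L = PolyMonoidMorphisms.IsMonoidHomomorphism A² A³ Δ⊗id-isMultiplicative
    module R = PolyMonoidMorphisms.IsMonoidHomomorphism A² A³ id⊗Δ-isMultiplicative
    on-skew : ∀ {G t} → t ≋ skew G → LΔ G ≋ skew G → Δ⊗id t ≋ id⊗Δ t
    on-skew {G} t≋ LΔG w = trans (L.⟦⟧-cong t≋ w) (trans (skew-coassoc G LΔG w) (R.⟦⟧-cong (λ v → sym (t≋ v)) w))

  infixl 7 _⋆_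
  _⋆_ : Poly A → Poly A → Poly A
  (f ⋆ g) m = ⟨ f ⊗ g ∣ Δᴾ m ⟩[ A² ]

  conv≈⋆ : ∀ f g m → conv f g m ≈ (f ⋆ g) m
  conv≈⋆ f g m = sumMono≈∑ (λ n₁ → sumMono≈∑ (λ n₂ → refl))

  ε≋1ᴾ : ε ≋ 1ᴾ A
  ε≋1ᴾ = X^0Y^0

  ⋆-cong : ∀ {f f′ g g′} → f ≋ f′ → g ≋ g′ → f ⋆ g ≋ f′ ⋆ g′
  ⋆-cong f≋f′ g≋g′ m = pair-congˡ A² (Δᴾ m) (⊗-cong f≋f′ g≋g′)

  ⋆-identityʳ : ∀ f → f ⋆ 1ᴾ A ≋ f
  ⋆-identityʳ f m = trans (pair-⊗1ᴾ A A f (Δᴾ m)) (trans (pair-cong A f (Δᴾ-counitʳ m)) (pair-basis A f m))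

  ⋆-identityˡ : ∀ g → 1ᴾ A ⋆ g ≋ g
  ⋆-identityˡ g m = trans (pair-1ᴾ⊗ A A g (Δᴾ m)) (trans (pair-cong A g (Δᴾ-counitˡ m)) (pair-basis A g m))

  ⋆-assoc : ∀ f g h → (f ⋆ g) ⋆ h ≋ f ⋆ (g ⋆ h)
  ⋆-assoc f g h m = begin
    ⟨ (f ⋆ g) ⊗ h ∣ Δᴾ m ⟩[ A² ]
      ≈⟨ pair-congˡ A² (Δᴾ m) (λ { (n₁ , n₂) →
           trans (pair-⊗ A² A (f ⊗ g) h (Δᴾ n₁) (basis A n₂)) (*-congˡ (pair-basis A h n₂)) }) ⟨
    ⟨ (λ n → ⟨ (f ⊗ g) ⊗ h ∣ (Δᴾ ⊗ᴷ basis A) n ⟩[ A³ ]) ∣ Δᴾ m ⟩[ A² ]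
      ≈⟨ pair-linear A² A³ (Δᴾ ⊗ᴷ basis A) ((f ⊗ g) ⊗ h) (Δᴾ m) ⟨
    ⟨ (f ⊗ g) ⊗ h ∣ Δ⊗id (Δᴾ m) ⟩[ A³ ]
      ≈⟨ pair-cong A³ ((f ⊗ g) ⊗ h) (Δᴾ-coassoc m) ⟩
    ⟨ (f ⊗ g) ⊗ h ∣ id⊗Δ (Δᴾ m) ⟩[ A³ ]
      ≈⟨ pair-assocʳ A A A f g h _ ⟩
    ⟨ f ⊗ (g ⊗ h) ∣ linear A² (A ⊠ A²) (basis A ⊗ᴷ Δᴾ) (Δᴾ m) ⟩[ A ⊠ A² ]
      ≈⟨ pair-linear A² (A ⊠ A²) (basis A ⊗ᴷ Δᴾ) (f ⊗ (g ⊗ h)) (Δᴾ m) ⟩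
    ⟨ (λ n → ⟨ f ⊗ (g ⊗ h) ∣ (basis A ⊗ᴷ Δᴾ) n ⟩[ A ⊠ A² ]) ∣ Δᴾ m ⟩[ A² ]
      ≈⟨ pair-congˡ A² (Δᴾ m) (λ { (n₁ , n₂) →
           trans (pair-⊗ A A² f (g ⊗ h) (basis A n₁) (Δᴾ n₂)) (*-congʳ (pair-basis A f n₁)) }) ⟩
    ⟨ f ⊗ (g ⋆ h) ∣ Δᴾ m ⟩[ A² ] ∎

  χ : ℕ → Poly A → Carrier
  χ r f = ⟨ f ∣ u ^[ A ] r ⟩[ A ]

  χ-⋆ : ∀ r f g → χ r (f ⋆ g) ≈ χ r f * χ r g
  χ-⋆ r f g = begin
    ⟨ f ⋆ g ∣ u ^[ A ] r ⟩[ A ]                   ≈⟨ pair-linear A A² Δᴾ (f ⊗ g) (u ^[ A ] r) ⟨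
    ⟨ f ⊗ g ∣ LΔ (u ^[ A ] r) ⟩[ A² ]             ≈⟨ pair-cong A² (f ⊗ g) (LΔ-u^ r) ⟩
    ⟨ f ⊗ g ∣ u ^[ A ] r ⊗ u ^[ A ] r ⟩[ A² ]     ≈⟨ pair-⊗ A A f g _ _ ⟩
    χ r f * χ r g                                 ∎

  χ-1ᴾ : ∀ r → χ r (1ᴾ A) ≈ 1#
  χ-1ᴾ r = trans (∑-cong A (λ x → *-comm _ _))
    (trans (∑-δ= A (0ₑ A) (u ^[ A ] r)) (^-at-0ₑ A u r u-at-0ₑ))

  χ-periodic : ∀ r f → χ (p ℕ.+ r) f ≈ χ r f
  χ-periodic r f = pair-cong A f (u^-periodic r)

  sumℕ≈sum : ∀ n g → sumℕ n g ≈ sum {n} (λ k → g (toℕ k))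
  sumℕ≈sum zero    g = refl
  sumℕ≈sum (suc n) g = begin
    sumℕ n g + g n                                              ≈⟨ +-congʳ (sumℕ≈sum n g) ⟩
    sum {n} (λ k → g (toℕ k)) + g n
      ≈⟨ +-cong (FinSum.sum-cong-≋ {n} (λ k → reflexive (≡.cong g (≡.sym (Fin.toℕ-inject₁ k)))))
                (reflexive (≡.cong g (≡.sym (Fin.toℕ-fromℕ n)))) ⟩
    sum {n} (λ k → g (toℕ (Fin.inject₁ k))) + g (toℕ (Fin.fromℕ n)) ≈⟨ FinSum.sum-init-last (λ k → g (toℕ k)) ⟨
    sum {suc n} (λ k → g (toℕ k))                               ∎
    where module FinSum = Algebra.Properties.Semiring.Sum semiring

  T≈pair : ∀ f a b → T f a b ≈ ⟨ f ∣ X^ a Y^ b ⟩[ A ]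
  T≈pair f a b = sumMono≈∑ (λ m → refl)

  u^-expansion : ∀ r m → (u ^[ A ] r) m ≈ sum {suc r} (λ k → fromℕ (r C toℕ k) * pow lam (toℕ k) * (X^ toℕ k Y^ 0) m)
  u^-expansion r m = begin
    (u ^[ A ] r) m                                            ≈⟨ ^-cong A r (λ x → +-comm _ _) m ⟩
    ((lam • X +ᴾ 1ᴾ A) ^[ A ] r) m                            ≈⟨ Binomial.theorem r (lam • X) (1ᴾ A) m ⟩
    PolySum.sum A (Binomial.binomialTerm (lam • X) (1ᴾ A) r) m
      ≈⟨ sumᴾ-at A (suc r) (Binomial.binomialTerm (lam • X) (1ᴾ A) r) m ⟩
    sum {suc r} (λ k → Binomial.binomialTerm (lam • X) (1ᴾ A) r k m)  ≈⟨ FinSum.sum-cong-≋ {suc r} term ⟩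
    sum {suc r} (λ k → fromℕ (r C toℕ k) * pow lam (toℕ k) * (X^ toℕ k Y^ 0) m) ∎
    where
    module Binomial = Algebra.Properties.CommutativeSemiring.Binomial (Poly-commutativeSemiring A)
    module FinSum = Algebra.Properties.Semiring.Sum semiring
    λX^ : ∀ k j → ((lam • X) ^[ A ] k ·[ A ] 1ᴾ A ^[ A ] j) m ≈ pow lam k * (X^ k Y^ 0) m
    λX^ k j = begin
      ((lam • X) ^[ A ] k ·[ A ] 1ᴾ A ^[ A ] j) m         ≈⟨ ·-cong A (•-^ A lam X k) (1ᴾ-^ A j) m ⟩
      ((pow lam k • X ^[ A ] k) ·[ A ] 1ᴾ A) m           ≈⟨ trans (·-comm A _ _ m) (·-identityˡ A _ m) ⟩
      pow lam k * (X ^[ A ] k) m                         ≈⟨ *-congˡ (X^Y^-^ 1 0 k m) ⟩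
      pow lam k * (X^ (k ℕ.* 1) Y^ (k ℕ.* 0)) m         ≡⟨ ≡.cong₂ (λ i j → pow lam k * (X^ i Y^ j) m) (ℕ.*-identityʳ k) (ℕ.*-zeroʳ k) ⟩
      pow lam k * (X^ k Y^ 0) m                          ∎
    term : ∀ k → Binomial.binomialTerm (lam • X) (1ᴾ A) r k m ≈ fromℕ (r C toℕ k) * pow lam (toℕ k) * (X^ toℕ k Y^ 0) m
    term k = trans (×ᴾ-at A (r C toℕ k) _ m) (trans (*-congˡ (λX^ (toℕ k) (r ℕ.∸ toℕ k))) (sym (*-assoc _ _ _)))

  χ-expansion : ∀ r f → χ r f ≈ sumℕ (suc r) (λ k → fromℕ (r C k) * pow lam k * T f k 0)
  χ-expansion r f = begin
    ∑ A (λ m → (u ^[ A ] r) m * f m)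
      ≈⟨ ∑-cong A (λ m → trans (*-congʳ (u^-expansion r m))
           (FinSum.*-distribʳ-sum {suc r} (f m) (λ k → fromℕ (r C toℕ k) * pow lam (toℕ k) * (X^ toℕ k Y^ 0) m))) ⟩
    ∑ A (λ m → sum {suc r} (λ k → fromℕ (r C toℕ k) * pow lam (toℕ k) * (X^ toℕ k Y^ 0) m * f m))
      ≈⟨ ∑-comm-sum A (suc r) (λ k m → fromℕ (r C toℕ k) * pow lam (toℕ k) * (X^ toℕ k Y^ 0) m * f m) ⟩
    sum {suc r} (λ k → ∑ A (λ m → fromℕ (r C toℕ k) * pow lam (toℕ k) * (X^ toℕ k Y^ 0) m * f m))
      ≈⟨ FinSum.sum-cong-≋ {suc r} (λ k → trans (∑-cong A (λ m → *-assoc _ ((X^ toℕ k Y^ 0) m) (f m)))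
           (sym (*-distribˡ-∑ A (fromℕ (r C toℕ k) * pow lam (toℕ k)) _))) ⟩
    sum {suc r} (λ k → fromℕ (r C toℕ k) * pow lam (toℕ k) * ⟨ f ∣ X^ toℕ k Y^ 0 ⟩[ A ])
      ≈⟨ FinSum.sum-cong-≋ {suc r} (λ k → *-congˡ {fromℕ (r C toℕ k) * pow lam (toℕ k)} (T≈pair f (toℕ k) 0)) ⟨
    sum {suc r} (λ k → fromℕ (r C toℕ k) * pow lam (toℕ k) * T f (toℕ k) 0)
      ≈⟨ sumℕ≈sum (suc r) (λ k → fromℕ (r C k) * pow lam k * T f k 0) ⟨
    sumℕ (suc r) (λ k → fromℕ (r C k) * pow lam k * T f k 0) ∎
    where module FinSum = Algebra.Properties.Semiring.Sum semiring

  X^Y^-above : ∀ a b n → a < e₁ n ⊎ b < e₂ n → (X^ a Y^ b) n ≈ 0#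
  X^Y^-above a b n (inj₁ a<) = trans (*-congʳ (δ-≢ (λ e → ℕ.<-irrefl (≡.sym e) a<))) (zeroˡ _)
  X^Y^-above a b n (inj₂ b<) = trans (*-congˡ (δ-≢ (λ e → ℕ.<-irrefl (≡.sym e) b<))) (zeroʳ _)

  X^Y^-at : ∀ a b n → e₁ n ≡ a → e₂ n ≡ b → (X^ a Y^ b) n ≈ 1#
  X^Y^-at a b n e₁≡a e₂≡b = trans (*-cong (δ-≡ e₁≡a) (δ-≡ e₂≡b)) (*-identityˡ 1#)

  -- t = w ⊗ X^a Y^b + (terms whose right factor has smaller exponents)
  record RightLeading (t : Poly A²) (a b : ℕ) (w : Poly A) : Set ℓ where
    field
      above : ∀ n₁ n₂ → a < e₁ n₂ ⊎ b < e₂ n₂ → t (n₁ , n₂) ≈ 0#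
      at    : ∀ n₁ n₂ → e₁ n₂ ≡ a → e₂ n₂ ≡ b → t (n₁ , n₂) ≈ w n₁

  RightLeading-cong : ∀ {t t′ a b w w′} → t ≋ t′ → w ≋ w′ → RightLeading t a b w → RightLeading t′ a b w′
  RightLeading-cong t≋t′ w≋w′ t-lead = record
    { above = λ n₁ n₂ h → trans (sym (t≋t′ _)) (above n₁ n₂ h)
    ; at    = λ n₁ n₂ e e′ → trans (sym (t≋t′ _)) (trans (at n₁ n₂ e e′) (w≋w′ n₁)) }
    where open RightLeading t-lead

  RightLeading-index : ∀ {t a b a′ b′ w} → a ≡ a′ → b ≡ b′ → RightLeading t a b w → RightLeading t a′ b′ w
  RightLeading-index ≡.refl ≡.refl t-lead = t-lead

  1ᴾ-rightLeading : RightLeading (1ᴾ A²) 0 0 (1ᴾ A)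
  1ᴾ-rightLeading = record
    { above = λ n₁ n₂ h → trans (*-congˡ (trans (sym (X^0Y^0 n₂)) (X^Y^-above 0 0 n₂ h))) (zeroʳ _)
    ; at    = λ n₁ n₂ e e′ → trans (*-congˡ (trans (sym (X^0Y^0 n₂)) (X^Y^-at 0 0 n₂ e e′))) (*-identityʳ _) }

  skew-rightLeading : ∀ a b → 0 < a ⊎ 0 < b → RightLeading (skew (X^ a Y^ b)) a b u
  skew-rightLeading a b nonconstant = record { above = above ; at = at }
    where
    1ᴾ≈0 : ∀ n → 0 < e₁ n ⊎ 0 < e₂ n → 1ᴾ A n ≈ 0#
    1ᴾ≈0 n h = trans (sym (X^0Y^0 n)) (X^Y^-above 0 0 n h)
    above : ∀ n₁ n₂ → a < e₁ n₂ ⊎ b < e₂ n₂ → skew (X^ a Y^ b) (n₁ , n₂) ≈ 0#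
    above n₁ n₂ h = begin
      (X^ a Y^ b) n₁ * 1ᴾ A n₂ + u n₁ * (X^ a Y^ b) n₂
        ≈⟨ +-cong (*-congˡ (1ᴾ≈0 n₂ (map (ℕ.≤-<-trans z≤n) (ℕ.≤-<-trans z≤n) h))) (*-congˡ (X^Y^-above a b n₂ h)) ⟩
      (X^ a Y^ b) n₁ * 0# + u n₁ * 0#  ≈⟨ +-cong (zeroʳ _) (zeroʳ _) ⟩
      0# + 0#                          ≈⟨ +-identityˡ 0# ⟩
      0#                               ∎
    at : ∀ n₁ n₂ → e₁ n₂ ≡ a → e₂ n₂ ≡ b → skew (X^ a Y^ b) (n₁ , n₂) ≈ u n₁
    at n₁ n₂ ≡.refl ≡.refl = begin
      (X^ a Y^ b) n₁ * 1ᴾ A n₂ + u n₁ * (X^ a Y^ b) n₂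
        ≈⟨ +-cong (*-congˡ (1ᴾ≈0 n₂ nonconstant)) (*-congˡ (X^Y^-at a b n₂ ≡.refl ≡.refl)) ⟩
      (X^ a Y^ b) n₁ * 0# + u n₁ * 1#  ≈⟨ +-cong (zeroʳ _) (*-identityʳ _) ⟩
      0# + u n₁                        ≈⟨ +-identityˡ _ ⟩
      u n₁                             ∎

  module _ {s t a b a′ b′ w w′} (s-lead : RightLeading s a b w) (t-lead : RightLeading t a′ b′ w′) where
    private
      module S = RightLeading s-lead
      module T = RightLeading t-lead

    sliceProduct : Exponent A → Exponent A → Exponent A → Carrier
    sliceProduct n₁ x′ y′ = ((λ x → s (x , x′)) ·[ A ] (λ y → t (y , y′))) n₁

    sliceProduct≈0 : ∀ n₁ x′ y′ → (a < e₁ x′ ⊎ b < e₂ x′) ⊎ (a′ < e₁ y′ ⊎ b′ < e₂ y′) → sliceProduct n₁ x′ y′ ≈ 0#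
    sliceProduct≈0 n₁ x′ y′ (inj₁ x′-above) =
      trans (·-cong A (λ x → S.above x x′ x′-above) (λ _ → refl) n₁) (·-zeroˡ A _ n₁)
    sliceProduct≈0 n₁ x′ y′ (inj₂ y′-above) =
      trans (·-comm A _ _ n₁) (trans (·-cong A (λ y → T.above y y′ y′-above) (λ _ → refl) n₁) (·-zeroˡ A _ n₁))

    sliceProduct≈0₁ : ∀ n₁ x′ y′ → a < e₁ x′ ⊎ a′ < e₁ y′ → sliceProduct n₁ x′ y′ ≈ 0#
    sliceProduct≈0₁ n₁ x′ y′ =
      [ (λ h → sliceProduct≈0 n₁ x′ y′ (inj₁ (inj₁ h))) , (λ h → sliceProduct≈0 n₁ x′ y′ (inj₂ (inj₁ h))) ]

    sliceProduct≈0₂ : ∀ n₁ x′ y′ → b < e₂ x′ ⊎ b′ < e₂ y′ → sliceProduct n₁ x′ y′ ≈ 0#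
    sliceProduct≈0₂ n₁ x′ y′ =
      [ (λ h → sliceProduct≈0 n₁ x′ y′ (inj₁ (inj₂ h))) , (λ h → sliceProduct≈0 n₁ x′ y′ (inj₂ (inj₂ h))) ]

    ·-above : ∀ n₁ n₂ → a ℕ.+ a′ < e₁ n₂ ⊎ b ℕ.+ b′ < e₂ n₂ → (s ·[ A² ] t) (n₁ , n₂) ≈ 0#
    ·-above n₁ n₂ h = trans (·-sliceʳ A A s t n₁ n₂) (∑-zero (A ⊠ A) (λ { (x′ , y′) → summand≈0 x′ y′ h }))
      where
      summand≈0 : ∀ x′ y′ → a ℕ.+ a′ < e₁ n₂ ⊎ b ℕ.+ b′ < e₂ n₂ → δ+ A x′ y′ n₂ * sliceProduct n₁ x′ y′ ≈ 0#
      summand≈0 x′ y′ (inj₁ h₁) = trans (*-assoc _ _ _)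
        (δ-+-above _ _ _ a a′ h₁ (λ h → trans (*-congˡ (sliceProduct≈0₁ n₁ x′ y′ h)) (zeroʳ _)))
      summand≈0 x′ y′ (inj₂ h₂) = trans (trans (*-congʳ (*-comm _ _)) (*-assoc _ _ _))
        (δ-+-above _ _ _ b b′ h₂ (λ h → trans (*-congˡ (sliceProduct≈0₂ n₁ x′ y′ h)) (zeroʳ _)))

    ·-at-summand : ∀ n₁ n₂ x′ y′ → e₁ n₂ ≡ a ℕ.+ a′ → e₂ n₂ ≡ b ℕ.+ b′ →
                   δ+ A x′ y′ n₂ * sliceProduct n₁ x′ y′ ≈ ((X^ a Y^ b) x′ * (X^ a′ Y^ b′) y′) * (w ·[ A ] w′) n₁
    ·-at-summand n₁ n₂ x′ y′ e₁≡ e₂≡ = begin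
      δ (e₁ x′ ℕ.+ e₁ y′) (e₁ n₂) * δ (e₂ x′ ℕ.+ e₂ y′) (e₂ n₂) * Z
        ≡⟨ ≡.cong₂ (λ i j → δ (e₁ x′ ℕ.+ e₁ y′) i * δ (e₂ x′ ℕ.+ e₂ y′) j * Z) e₁≡ e₂≡ ⟩
      δ (e₁ x′ ℕ.+ e₁ y′) (a ℕ.+ a′) * δ (e₂ x′ ℕ.+ e₂ y′) (b ℕ.+ b′) * Z
        ≈⟨ *-assoc _ _ _ ⟩
      δ (e₁ x′ ℕ.+ e₁ y′) (a ℕ.+ a′) * (δ (e₂ x′ ℕ.+ e₂ y′) (b ℕ.+ b′) * Z)
        ≈⟨ *-congˡ (δ-+-split _ _ b b′ (sliceProduct≈0₂ n₁ x′ y′)) ⟩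
      δ (e₁ x′ ℕ.+ e₁ y′) (a ℕ.+ a′) * (δ (e₂ x′) b * δ (e₂ y′) b′ * Z)
        ≈⟨ δ-+-split _ _ a a′ (λ h → trans (*-congˡ (sliceProduct≈0₁ n₁ x′ y′ h)) (zeroʳ _)) ⟩
      δ (e₁ x′) a * δ (e₁ y′) a′ * (δ (e₂ x′) b * δ (e₂ y′) b′ * Z)
        ≈⟨ δ²-*-cong _ _ _ _ (λ e₁x′ e₁y′ → δ²-*-cong _ _ _ _ (λ e₂x′ e₂y′ →
             ·-cong A (λ x → S.at x x′ e₁x′ e₂x′) (λ y → T.at y y′ e₁y′ e₂y′) n₁)) ⟩
      δ (e₁ x′) a * δ (e₁ y′) a′ * (δ (e₂ x′) b * δ (e₂ y′) b′ * (w ·[ A ] w′) n₁)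
        ≈⟨ solve 5 (λ d₁ d₁′ d₂ d₂′ W → d₁ :* d₁′ :* (d₂ :* d₂′ :* W) := d₁ :* d₂ :* (d₁′ :* d₂′) :* W) refl _ _ _ _ _ ⟩
      ((X^ a Y^ b) x′ * (X^ a′ Y^ b′) y′) * (w ·[ A ] w′) n₁ ∎
      where Z = sliceProduct n₁ x′ y′

    ·-at : ∀ n₁ n₂ → e₁ n₂ ≡ a ℕ.+ a′ → e₂ n₂ ≡ b ℕ.+ b′ → (s ·[ A² ] t) (n₁ , n₂) ≈ (w ·[ A ] w′) n₁
    ·-at n₁ n₂ e₁≡ e₂≡ = begin
      (s ·[ A² ] t) (n₁ , n₂)
        ≈⟨ ·-sliceʳ A A s t n₁ n₂ ⟩
      ∑ A (λ x′ → ∑ A (λ y′ → δ+ A x′ y′ n₂ * sliceProduct n₁ x′ y′))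
        ≈⟨ ∑-cong (A ⊠ A) (λ { (x′ , y′) → ·-at-summand n₁ n₂ x′ y′ e₁≡ e₂≡ }) ⟩
      ∑ A (λ x′ → ∑ A (λ y′ → ((X^ a Y^ b) x′ * (X^ a′ Y^ b′) y′) * (w ·[ A ] w′) n₁))
        ≈⟨ trans (sym (*-distribʳ-∑ (A ⊠ A) _ _)) (*-congʳ (∑-*-∑ A A _ _)) ⟩
      (∑ A (X^ a Y^ b) * ∑ A (X^ a′ Y^ b′)) * (w ·[ A ] w′) n₁
        ≈⟨ *-congʳ (trans (*-cong (∑-X^Y^ a b a<p b<p) (∑-X^Y^ a′ b′ a′<p b′<p)) (*-identityˡ 1#)) ⟩
      1# * (w ·[ A ] w′) n₁
        ≈⟨ *-identityˡ _ ⟩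
      (w ·[ A ] w′) n₁ ∎
      where
      a+a′<p = ≡.subst (_< p) e₁≡ (Fin.toℕ<n (proj₁ n₂))
      b+b′<p = ≡.subst (_< p) e₂≡ (Fin.toℕ<n (proj₂ n₂))
      a<p  = ℕ.≤-<-trans (ℕ.m≤m+n a a′) a+a′<p
      a′<p = ℕ.≤-<-trans (ℕ.m≤n+m a′ a) a+a′<p
      b<p  = ℕ.≤-<-trans (ℕ.m≤m+n b b′) b+b′<p
      b′<p = ℕ.≤-<-trans (ℕ.m≤n+m b′ b) b+b′<p

    ·-rightLeading : RightLeading (s ·[ A² ] t) (a ℕ.+ a′) (b ℕ.+ b′) (w ·[ A ] w′)
    ·-rightLeading = record { above = ·-above ; at = ·-at }

  ^-rightLeading : ∀ {t a b w} → RightLeading t a b w → ∀ n → RightLeading (t ^[ A² ] n) (n ℕ.* a) (n ℕ.* b) (w ^[ A ] n)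
  ^-rightLeading t-lead zero    = 1ᴾ-rightLeading
  ^-rightLeading t-lead (suc n) = ·-rightLeading t-lead (^-rightLeading t-lead n)

  Δᴾ-rightLeading : ∀ m → RightLeading (Δᴾ m) (e₁ m) (e₂ m) (u ^[ A ] (e₁ m ℕ.+ e₂ m))
  Δᴾ-rightLeading m = RightLeading-cong (λ x → sym (Δᴾ-form m x)) (λ x → sym (^-homo-· A u (e₁ m) (e₂ m) x))
    (RightLeading-index
      (≡.trans (≡.cong₂ ℕ._+_ (ℕ.*-identityʳ (e₁ m)) (ℕ.*-zeroʳ (e₂ m))) (ℕ.+-identityʳ (e₁ m)))
      (≡.cong₂ ℕ._+_ (ℕ.*-zeroʳ (e₁ m)) (ℕ.*-identityʳ (e₂ m)))
      (·-rightLeading (^-rightLeading ΔX-leading (e₁ m)) (^-rightLeading ΔY-leading (e₂ m))))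
    where
    ΔX-leading = RightLeading-cong (λ x → sym (ΔX-skew x)) (λ _ → refl) (skew-rightLeading 1 0 (inj₁ (s≤s z≤n)))
    ΔY-leading = RightLeading-cong (λ x → sym (ΔY-skew x)) (λ _ → refl) (skew-rightLeading 0 1 (inj₂ (s≤s z≤n)))

  deg : Exponent A → ℕ
  deg m = e₁ m ℕ.+ e₂ m

  coefficient : Poly A → Exponent A → Exponent A → Carrier
  coefficient f m n = ⟨ f ∣ (λ n₁ → Δᴾ m (n₁ , n)) ⟩[ A ]

  ⋆-as-matrix : ∀ f g m → (f ⋆ g) m ≈ ∑ A (λ n → coefficient f m n * g n)
  ⋆-as-matrix f g m = trans (∑-comm A A _) (∑-cong A (λ n →
    trans (∑-cong A (λ n₁ → sym (*-assoc _ _ _))) (sym (*-distribʳ-∑ A (g n) _))))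

  coefficient-diagonal : ∀ f m → coefficient f m m ≈ χ (deg m) f
  coefficient-diagonal f m = pair-cong A f (λ n₁ → RightLeading.at (Δᴾ-rightLeading m) n₁ m ≡.refl ≡.refl)

  coefficient-lower : ∀ f m n → n ≢ m → deg m ≤ deg n → coefficient f m n ≈ 0#
  coefficient-lower f m n n≢m deg-m≤n =
    ∑-zero A (λ n₁ → trans (*-congʳ (RightLeading.above (Δᴾ-rightLeading m) n₁ n n-above-m)) (zeroˡ _))
    where
    n-above-m : e₁ m < e₁ n ⊎ e₂ m < e₂ n
    n-above-m with e₁ m ℕ.<? e₁ n | e₂ m ℕ.<? e₂ n
    ... | yes h | _     = inj₁ h
    ... | no _  | yes h = inj₂ h
    ... | no h₁ | no h₂ with e₁ n ℕ.≟ e₁ m | e₂ n ℕ.≟ e₂ m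
    ...   | yes e | yes e′ = ⊥-elim (n≢m (≡.cong₂ _,_ (Fin.toℕ-injective e) (Fin.toℕ-injective e′)))
    ...   | no e  | _      = ⊥-elim (ℕ.<⇒≱ (ℕ.+-mono-<-≤ (ℕ.≤∧≢⇒< (ℕ.≮⇒≥ h₁) e) (ℕ.≮⇒≥ h₂)) deg-m≤n)
    ...   | yes _ | no e′  = ⊥-elim (ℕ.<⇒≱ (ℕ.+-mono-≤-< (ℕ.≮⇒≥ h₁) (ℕ.≤∧≢⇒< (ℕ.≮⇒≥ h₂) e′)) deg-m≤n)

  χ-IsUnit-<2p : ∀ f → (∀ r → r < p → IsUnit (χ r f)) → ∀ r → r < p ℕ.+ p → IsUnit (χ r f)
  χ-IsUnit-<2p f χ-units r r<2p with r ℕ.<? p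
  ... | yes r<p = χ-units r r<p
  ... | no  r≮p = IsUnit-resp-≈ χ[r∸p]≈χr (χ-units (r ℕ.∸ p) r∸p<p)
    where
    p+[r∸p]≡r = ℕ.m+[n∸m]≡n (ℕ.≮⇒≥ r≮p)
    χ[r∸p]≈χr = trans (sym (χ-periodic (r ℕ.∸ p) f)) (reflexive (≡.cong (λ k → χ k f) p+[r∸p]≡r))
    r∸p<p = ℕ.+-cancelˡ-< p (r ℕ.∸ p) p (≡.subst (_< p ℕ.+ p) (≡.sym p+[r∸p]≡r) r<2p)

  deg<2p : ∀ m → deg m < p ℕ.+ p
  deg<2p (m₁ , m₂) = ℕ.+-mono-< (Fin.toℕ<n m₁) (Fin.toℕ<n m₂)

  rightInverse : ∀ f → (∀ r → r < p → IsUnit (χ r f)) → ∃ λ g → f ⋆ g ≋ 1ᴾ A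
  rightInverse f χ-units = g , λ m → trans (⋆-as-matrix f g m) (solves m)
    where
    diagonal-unit : ∀ m → IsUnit (coefficient f m m)
    diagonal-unit m = IsUnit-resp-≈ (sym (coefficient-diagonal f m)) (χ-IsUnit-<2p f χ-units (deg m) (deg<2p m))
    open TriangularSystem A (coefficient f) deg (coefficient-lower f)
           (λ m → proj₁ (diagonal-unit m)) (λ m → proj₂ (diagonal-unit m)) (1ᴾ A)
    g : Poly A
    g = proj₁ (solution (p ℕ.+ p) deg<2p)
    solves : ∀ m → ∑ A (λ n → coefficient f m n * g n) ≈ 1ᴾ A m
    solves = proj₂ (solution (p ℕ.+ p) deg<2p)

  χ-rightInverse : ∀ f g → f ⋆ g ≋ 1ᴾ A → ∀ r → χ r f * χ r g ≈ 1#
  χ-rightInverse f g fg≋1 r = trans (sym (χ-⋆ r f g)) (trans (pair-congˡ A (u ^[ A ] r) fg≋1) (χ-1ᴾ r))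

  ⋆-unit⇔χ-units : ∀ f → (∃ λ g → f ⋆ g ≋ 1ᴾ A × g ⋆ f ≋ 1ᴾ A) ⇔ (∀ r → r < p → IsUnit (χ r f))
  ⋆-unit⇔χ-units f = mk⇔
    (λ { (g , fg≋1 , _) r _ → χ r g , χ-rightInverse f g fg≋1 r })
    twoSided
    where
    twoSided : (∀ r → r < p → IsUnit (χ r f)) → ∃ λ g → f ⋆ g ≋ 1ᴾ A × g ⋆ f ≋ 1ᴾ A
    twoSided χ-units = g , fg≋1 , λ m → trans (⋆-cong {g} (λ _ → refl) f≋h m) (gh≋1 m)
      where
      g = proj₁ (rightInverse f χ-units)
      fg≋1 = proj₂ (rightInverse f χ-units)
      g-right = rightInverse g (λ r _ → χ r f , trans (*-comm _ _) (χ-rightInverse f g fg≋1 r))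
      h = proj₁ g-right
      gh≋1 = proj₂ g-right
      f≋h : f ≋ h
      f≋h m = begin
        f m                    ≈⟨ ⋆-identityʳ f m ⟨
        (f ⋆ 1ᴾ A) m           ≈⟨ ⋆-cong {f} (λ _ → refl) (λ n → sym (gh≋1 n)) m ⟩
        (f ⋆ (g ⋆ h)) m        ≈⟨ ⋆-assoc f g h m ⟨
        ((f ⋆ g) ⋆ h) m        ≈⟨ ⋆-cong {g = h} fg≋1 (λ _ → refl) m ⟩
        (1ᴾ A ⋆ h) m           ≈⟨ ⋆-identityˡ h m ⟩
        h m                    ∎

  χ-units⇔D-unit : ∀ f → (∀ r → r < p → IsUnit (χ r f)) ⇔ IsUnit (D f)
  χ-units⇔D-unit f = mk⇔
    (λ χ-units → IsUnit-prodℕ p (λ r r<p → IsUnit-pow p (IsUnit-resp-≈ (χ-expansion r f) (χ-units r r<p))))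
    (λ D-unit r r<p → IsUnit-resp-≈ (sym (χ-expansion r f)) (IsUnit-pow⁻ p (IsUnit-prodℕ⁻ p D-unit r r<p)))

  IsConvUnit⇔⋆-unit : ∀ f → IsConvUnit f ⇔ (∃ λ g → f ⋆ g ≋ 1ᴾ A × g ⋆ f ≋ 1ᴾ A)
  IsConvUnit⇔⋆-unit f = mk⇔
    (λ { (g , fg≈ε , gf≈ε) → g , (λ m → trans (sym (conv≈⋆ f g m)) (trans (fg≈ε m) (ε≋1ᴾ m)))
                               , (λ m → trans (sym (conv≈⋆ g f m)) (trans (gf≈ε m) (ε≋1ᴾ m))) })
    (λ { (g , fg≋1 , gf≋1) → g , (λ m → trans (conv≈⋆ f g m) (trans (fg≋1 m) (sym (ε≋1ᴾ m))))
                               , (λ m → trans (conv≈⋆ g f m) (trans (gf≋1 m) (sym (ε≋1ᴾ m)))) })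

  IsConvUnit⇔D-unit : ∀ f → IsConvUnit f ⇔ IsUnit (D f)
  IsConvUnit⇔D-unit f = χ-units⇔D-unit f ⇔-∘ (⋆-unit⇔χ-units f ⇔-∘ IsConvUnit⇔⋆-unit f)

corollary3p2 : {a ℓa b ℓb : Level} (p : ℕ) → Prime p
    → (R : CommutativeRing a ℓa)
    → CommutativeRing._≈_ R (RingOps.fromℕ R p) (CommutativeRing.0# R)
    → (lam : CommutativeRing.Carrier R)
    → (B : CommutativeRing b ℓb)
    → (φ : CommutativeRing.Carrier R → CommutativeRing.Carrier B)
    → IsRingHom R B φ
    → (f : GroupAlgebra.Point B p (φ lam))
    → GroupAlgebra.IsConvUnit B p (φ lam) f
      ⇔ RingOps.IsUnit B (GroupAlgebra.D B p (φ lam) f)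
corollary3p2 p p-prime R char-p lam B φ φ-homo =
  Gλ.IsConvUnit⇔D-unit B p p-prime (fromℕ≈0-homo R B φ-homo p char-p) (φ lam)
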